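{- Let $m\ge 2$, let $n_1,\dots,n_m$ be odd integers with $n_i\ge 5$, and let $\mathcal{C}=\mathcal{C}(C_{n_1},\dots,C_{n_m})$ be the chain cycle obtained by identifying $v^i_{\frac{n_i+1}{2}+1}$ with $v^{i+1}_1$ for each $i=1,\dots,m-1$. Then $sdim(\mathcal{C})=m-1+\lfloor\frac{n_1}{2}\rfloor+\lfloor\frac{n_m}{2}\rfloor+\sum_{i=2}^{m-1}\lfloor\frac{n_i-2}{2}\rfloor$.
   Context: The cycles $C_{n_1},\dots,C_{n_m}$ are pairwise disjoint, $V(C_{n_i})=\{v^i_1,\dots,v^i_{n_i}\}$ with $v^i_j$ adjacent to $v^i_{j+1}$ ($1\le j<n_i$) and $v^i_{n_i}$ adjacent to $v^i_1$; the chain cycle is obtained from their disjoint union by the stated identifications. A vertex $w$ strongly resolves distinct vertices $u,v$ of a connected graph $G$ if $u$ lies on a shortest $v$–$w$ path or $v$ lies on a shortest $u$–$w$ path. A set $W\subseteq V(G)$ is a strong resolving set if every pair of distinct vertices is strongly resolved by some $w\in W$. The strong metric dimension $sdim(G)$ is the minimum cardinality of a strong resolving set. -}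

module Defs where

open import Data.Nat using (ℕ; zero; suc; _+_; _≤_; _/_; _≡ᵇ_)
open import Data.Fin using (Fin; toℕ)
open import Data.Bool using (Bool; true; false; _∨_; not; T)
open import Data.List using (List; length)
open import Data.List.Membership.Propositional using (_∈_)
open import Data.List.Relation.Unary.Unique.Propositional using (Unique)
open import Data.Product using (Σ; _×_; _,_; proj₁; proj₂; ∃-syntax)
open import Data.Sum using (_⊎_)
open import Relation.Binary.PropositionalEquality using (_≡_; _≢_)

record Graph : Set₁ where
  field
    V   : Set
    Adj : V → V → Set
open Graph public

module _ (G : Graph) where
  data Walk : V G → V G → ℕ → Set where
    here : ∀ {u} → Walk u u 0
    step : ∀ {u v w k} → Adj G u v → Walk v w k → Walk u w (suc k)

  _∈W_ : ∀ {u v k} → V G → Walk u v k → Set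
  x ∈W (here {u}) = x ≡ u
  x ∈W (step {u} _ p) = (x ≡ u) ⊎ (x ∈W p)

  Dist : V G → V G → ℕ → Set
  Dist u v k = Walk u v k × (∀ k' → Walk u v k' → k ≤ k')

  OnShortestPath : V G → V G → V G → Set
  OnShortestPath u v w =
    Σ ℕ λ k → Dist v w k × Σ (Walk v w k) λ p → u ∈W p

  StronglyResolves : V G → V G → V G → Set
  StronglyResolves w u v = OnShortestPath u v w ⊎ OnShortestPath v u w

  StrongResolvingSet : List (V G) → Set
  StrongResolvingSet W =
    ∀ u v → u ≢ v → ∃[ w ] (w ∈ W × StronglyResolves w u v)

  SDim : ℕ → Set
  SDim k =
    (Σ (List (V G)) λ W → Unique W × StrongResolvingSet W × length W ≡ k)
    × (∀ W → Unique W → StrongResolvingSet W → k ≤ length W)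

-- Chain cycles.  Cycles are indexed by i : Fin m (0-based), cycle i has
-- n i vertices indexed by j : Fin (n i) (0-based); so the paper's v^i_j
-- is (i-1 , j-1).

module _ (m : ℕ) (n : Fin m → ℕ) where
  DU : Set
  DU = Σ (Fin m) λ i → Fin (n i)

  CycStep : ∀ {c} → Fin c → Fin c → Set
  CycStep {c} a b = (toℕ b ≡ suc (toℕ a)) ⊎ ((suc (toℕ a) ≡ c) × (toℕ b ≡ 0))

  DUAdj : DU → DU → Set
  DUAdj (i , a) (i' , b) =
    Σ (i ≡ i') λ { _≡_.refl → CycStep a b ⊎ CycStep b a }

  -- x (in the disjoint union) is identified with u: either x = u, or
  -- x = v^{i+1}_1 and u = v^i_{(n_i+1)/2+1}  (0-based: (i+1,0) and (i,(n_i+1)/2))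
  Glued : DU → DU → Set
  Glued x u = (x ≡ u)
    ⊎ ((toℕ (proj₁ x) ≡ suc (toℕ (proj₁ u)))
       × (toℕ (proj₂ x) ≡ 0)
       × (toℕ (proj₂ u) ≡ (n (proj₁ u) + 1) / 2))

  -- representatives of the identified vertices: all vertices except the
  -- v^{i}_1 with i ≥ 2 (which are identified with v^{i-1}_{(n+1)/2+1})
  isRep : DU → Bool
  isRep (i , j) = (toℕ i ≡ᵇ 0) ∨ not (toℕ j ≡ᵇ 0)

  chainCycle : Graph
  chainCycle = record
    { V   = Σ DU (λ x → T (isRep x))
    ; Adj = λ u v → Σ DU λ x → Σ DU λ y →
              Glued x (proj₁ u) × Glued y (proj₁ v) × DUAdj x y
    }

-- Write h i = ⌊n i / 2⌋, so that cycle i has 2 h i + 1 vertices. Distances in the chain cycle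
-- are explicit: one walks to the cycle of the target, crossing each cycle in between from its
-- first vertex to its exit vertex at cost h, and then goes around the target cycle.
-- Lower bound: a strong resolver of two mutually maximally distant vertices is one of them, so
-- every strong resolving set covers all such pairs. Inside a cycle the antipodal pairs of the
-- non-cut vertices form a path, whose vertex covers need h vertices in the two end cycles and
-- h − 1 in the middle ones, and pairs across two cycles force one more vertex in all cycles
-- but one. Upper bound: an explicit set W* has exactly this size, and no two vertices outside
-- it are mutually maximally distant, so pushing two vertices apart along a geodesic reaches W*.
module Submission where

open import Defs
open import Data.Nat using (ℕ; zero; suc; pred; >-nonZero; _+_; _*_; _∸_; _≤_; _<_; _⊓_; _/_; _%_; z≤n; s≤s; z<s; s<s; _≤ᵇ_; _≡ᵇ_)
open import Data.Nat.Properties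
open import Data.Nat.DivMod using (m≡m%n+[m/n]*n; m*n/n≡m; [m∸n]/n≡m/n∸1)
open import Data.Nat.ListAction using (sum)
open import Data.Nat.Tactic.RingSolver
import Algebra.Properties.CommutativeSemigroup +-commutativeSemigroup as +-CS
open import Data.Fin using (Fin; zero; suc; toℕ; fromℕ<; inject₁; fromℕ)
import Data.Fin.Properties as Fin
open import Data.Fin.Properties using (toℕ-injective; toℕ<n; fromℕ<-toℕ; toℕ-fromℕ<; toℕ-inject₁; toℕ-fromℕ)
open import Data.Bool using (Bool; true; false; if_then_else_; T; _∨_; _∧_; not)
open import Data.Bool.Properties using (T-∧; T-∨; T-irrelevant)
open import Data.Unit using (tt)
open import Data.Empty using (⊥; ⊥-elim)
open import Data.Product using (Σ; _×_; _,_; proj₁; proj₂; ∃-syntax; map₂)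
open import Data.Product.Properties using (≡-dec)
open import Data.Sum using (_⊎_; inj₁; inj₂; [_,_]′)
open import Data.List using (List; []; _∷_; concat; tabulate; length; map; allFin)
open import Data.List.Properties using (length-++; map-tabulate)
open import Data.List.Relation.Unary.All as All using (All; []; _∷_)
import Data.List.Relation.Unary.All.Properties as AllP
open import Data.List.Relation.Unary.AllPairs using ([]; _∷_)
open import Data.List.Relation.Unary.Any using (here; there)
open import Data.List.Relation.Unary.Unique.Propositional using (Unique)
import Data.List.Relation.Unary.Unique.Propositional.Properties as UP
open import Data.List.Membership.Propositional using (_∈_; _∉_)
open import Data.List.Membership.Propositional.Properties using (∈-concat⁺′; ∈-tabulate⁺)
import Data.List.Membership.DecPropositional as DecMem
open import Function using (_∘_; id)
open import Function.Bundles using (Equivalence)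
open Equivalence using (to; from)
open import Relation.Nullary using (¬_; yes; no; does)
open import Relation.Binary.Definitions using (DecidableEquality; Tri; tri<; tri≈; tri>)
open import Relation.Binary.PropositionalEquality hiding ([_])

module GraphDistance
  (G : Graph) (D : V G → V G → ℕ)
  (D-sym : ∀ u v → D u v ≡ D v u)
  (D-self : ∀ u → D u u ≡ 0)
  (D≡0⇒≡ : ∀ u v → D u v ≡ 0 → u ≡ v)
  (D-lipschitz : ∀ z {x y} → Adj G x y → D z y ≤ suc (D z x))
  (D-descent : ∀ z v k → D z v ≡ suc k → Σ (V G) λ y → Adj G v y × D z y ≡ k)
  where

  walk-by-descent : ∀ z v k → D z v ≡ k → Walk G v z k
  walk-by-descent z v zero e with D≡0⇒≡ z v e
  ... | refl = here
  walk-by-descent z v (suc k) e with D-descent z v k e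
  ... | y , a , e' = step a (walk-by-descent z y k e')

  D-walk-bound : ∀ {u v k} (p : Walk G u v k) z → D z v ≤ D z u + k
  D-walk-bound {u} here z = m≤m+n (D z u) 0
  D-walk-bound {u} (step {k = k} a p) z = begin
    _               ≤⟨ D-walk-bound p z ⟩
    _ + k           ≤⟨ +-monoˡ-≤ k (D-lipschitz z a) ⟩
    suc (D z u) + k ≡⟨ sym (+-suc (D z u) k) ⟩
    D z u + suc k   ∎
    where open ≤-Reasoning

  D≤length : ∀ {u v k} → Walk G u v k → D u v ≤ k
  D≤length {u} p = subst (_ ≤_) (cong (_+ _) (D-self u)) (D-walk-bound p u)

  geodesic : ∀ u v → Walk G u v (D u v)
  geodesic u v = walk-by-descent v u (D u v) (D-sym v u)

  D-isDist : ∀ u v → Dist G u v (D u v)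
  D-isDist u v = geodesic u v , λ _ p → D≤length p

  Dist⇒≡D : ∀ {u v k} → Dist G u v k → k ≡ D u v
  Dist⇒≡D {u} {v} (p , minimal) = ≤-antisym (minimal _ (geodesic u v)) (D≤length p)

  _++W_ : ∀ {a b c k l} → Walk G a b k → Walk G b c l → Walk G a c (k + l)
  here ++W q = q
  step x p ++W q = step x (p ++W q)

  ∈W-++ʳ : ∀ {a b c k l x} (p : Walk G a b k) (q : Walk G b c l) → _∈W_ G x q → _∈W_ G x (p ++W q)
  ∈W-++ʳ here q x∈q = x∈q
  ∈W-++ʳ (step _ p) q x∈q = inj₂ (∈W-++ʳ p q x∈q)

  start-∈W : ∀ {b c l} (q : Walk G b c l) → _∈W_ G b q
  start-∈W here = refl
  start-∈W (step _ _) = inj₁ refl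

  split-walk : ∀ {a b k x} (p : Walk G a b k) → _∈W_ G x p →
               Σ ℕ λ k₁ → Σ ℕ λ k₂ → Walk G a x k₁ × Walk G x b k₂ × k₁ + k₂ ≡ k
  split-walk here refl = 0 , 0 , here , here , refl
  split-walk (step {k = k} y p) (inj₁ refl) = 0 , suc k , here , step y p , refl
  split-walk (step y p) (inj₂ x∈p) with split-walk p x∈p
  ... | k₁ , k₂ , q₁ , q₂ , e = suc k₁ , k₂ , step y q₁ , q₂ , cong suc e

  D-triangle : ∀ u v w → D u w ≤ D u v + D v w
  D-triangle u v w = D≤length (geodesic u v ++W geodesic v w)

  onShortestPath-intro : ∀ u v w → D v w ≡ D v u + D u w → OnShortestPath G u v w
  onShortestPath-intro u v w e =
    D v w , D-isDist v w , subst (λ k → Σ (Walk G v w k) (_∈W_ G u)) (sym e)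
      (geodesic v u ++W geodesic u w , ∈W-++ʳ (geodesic v u) (geodesic u w) (start-∈W (geodesic u w)))

  MaximallyDistant : V G → V G → Set
  MaximallyDistant u v = ∀ y → Adj G u y → D v y ≤ D v u

  Escape : V G → V G → Set
  Escape u v = Σ (V G) λ y → Adj G u y × D v y ≡ suc (D v u)

  onShortestPath-maximallyDistant : ∀ {u v w} → OnShortestPath G u v w → MaximallyDistant u v → w ≡ u
  onShortestPath-maximallyDistant (k , dk , p , u∈p) max with split-walk p u∈p
  ... | _ , .0 , _ , here , _ = refl
  ... | k₁ , .(suc k₂) , q₁ , step {v = y} {k = k₂} a q₂ , e = ⊥-elim (1+n≰n (+-cancelˡ-≤ k₁ _ _ longer))
    where
      open ≤-Reasoning
      longer : k₁ + suc k₂ ≤ k₁ + k₂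
      longer = begin
        k₁ + suc k₂ ≡⟨ trans e (Dist⇒≡D dk) ⟩
        D _ _       ≤⟨ D-walk-bound q₂ _ ⟩
        D _ y + k₂  ≤⟨ +-monoˡ-≤ k₂ (≤-trans (max y a) (D≤length q₁)) ⟩
        k₁ + k₂     ∎

  mutuallyMaximallyDistant-resolver : ∀ {u v w} → MaximallyDistant u v → MaximallyDistant v u →
                                      StronglyResolves G w u v → w ≡ u ⊎ w ≡ v
  mutuallyMaximallyDistant-resolver mu mv (inj₁ s) = inj₁ (onShortestPath-maximallyDistant s mu)
  mutuallyMaximallyDistant-resolver mu mv (inj₂ s) = inj₂ (onShortestPath-maximallyDistant s mv)

  Aligned : V G → V G → V G → V G → Set
  Aligned u' u v v' = D u' v' ≡ D u' u + D u v + D v v'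

  aligned-reverse : ∀ {u' u v v'} → Aligned u' u v v' → Aligned v' v u u'
  aligned-reverse {u'} {u} {v} {v'} al = begin
    D v' u'                 ≡⟨ D-sym v' u' ⟩
    D u' v'                 ≡⟨ al ⟩
    D u' u + D u v + D v v'   ≡⟨ +-CS.xy∙z≈z∙yx (D u' u) (D u v) (D v v') ⟩
    D v v' + (D u v + D u' u) ≡⟨ cong₂ _+_ (D-sym v v') (cong₂ _+_ (D-sym u v) (D-sym u' u)) ⟩
    D v' v + (D v u + D u u') ≡⟨ sym (+-assoc (D v' v) _ _) ⟩
    D v' v + D v u + D u u'   ∎
    where open ≡-Reasoning

  aligned-suffix : ∀ {u' u v v'} → Aligned u' u v v' → D u v' ≡ D u v + D v v'
  aligned-suffix {u'} {u} {v} {v'} al = ≤-antisym (D-triangle u v v') (+-cancelˡ-≤ (D u' u) _ _ (begin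
    D u' u + (D u v + D v v') ≡⟨ sym (+-assoc (D u' u) _ _) ⟩
    D u' u + D u v + D v v'   ≡⟨ sym al ⟩
    D u' v'                   ≤⟨ D-triangle u' u v' ⟩
    D u' u + D u v'           ∎))
    where open ≤-Reasoning

  aligned-extend : ∀ {u' u v v' y} → Aligned u' u v v' → Adj G u' y → D v' y ≡ suc (D v' u') →
                   Aligned y u v v'
  aligned-extend {u'} {u} {v} {v'} {y} al adj away = begin-equality
    D y v'                        ≡⟨ farther ⟩
    suc (D u' v')                 ≡⟨ cong suc al ⟩
    suc (D u' u) + D u v + D v v' ≡⟨ cong (λ x → x + D u v + D v v') (sym y-from-u) ⟩
    D y u + D u v + D v v'        ∎
    where
      open ≤-Reasoning
      farther : D y v' ≡ suc (D u' v')
      farther = trans (D-sym y v') (trans away (cong suc (D-sym v' u')))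
      y-from-u : D y u ≡ suc (D u' u)
      y-from-u = ≤-antisym
        (subst₂ (λ a b → a ≤ suc b) (D-sym u y) (D-sym u u') (D-lipschitz u adj))
        (+-cancelʳ-≤ (D u v + D v v') _ _ (begin
          suc (D u' u) + (D u v + D v v') ≡⟨ cong suc (sym (+-assoc (D u' u) _ _)) ⟩
          suc (D u' u + D u v + D v v')   ≡⟨ cong suc (sym al) ⟩
          suc (D u' v')                   ≡⟨ sym farther ⟩
          D y v'                          ≤⟨ D-triangle y u v' ⟩
          D y u + D u v'                  ≡⟨ cong (D y u +_) (aligned-suffix al) ⟩
          D y u + (D u v + D v v')        ∎))

  module EscapeCriterion (_≟_ : DecidableEquality (V G)) (W : List (V G))
    (B : ℕ) (D≤B : ∀ u v → D u v ≤ B)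
    (escape : ∀ u v → u ∉ W → v ∉ W → u ≢ v → Escape u v ⊎ Escape v u)
    where
    open DecMem _≟_ using (_∈?_)

    -- A pair u, v is pushed apart along a geodesic u' … u … v … v' until one end enters W;
    -- each step moves one end away from the other, and their distance is bounded by B.
    module _ {u v : V G} (u≢v : u ≢ v) where
      Resolver : Set
      Resolver = ∃[ w ] (w ∈ W × StronglyResolves G w u v)

      ends-distinct : ∀ {u' v'} → Aligned u' u v v' → u' ≢ v'
      ends-distinct {u'} al refl = u≢v (D≡0⇒≡ u v (m+n≡0⇒n≡0 (D u' u) (m+n≡0⇒m≡0 _ (trans (sym al) (D-self u')))))

      resolverˡ : ∀ {u' v'} → Aligned u' u v v' → StronglyResolves G u' u v
      resolverˡ al = inj₁ (onShortestPath-intro _ _ _ (aligned-suffix (aligned-reverse al)))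

      resolverʳ : ∀ {u' v'} → Aligned u' u v v' → StronglyResolves G v' u v
      resolverʳ al = inj₂ (onShortestPath-intro _ _ _ (aligned-suffix al))

      resolver-along : ∀ fuel {u' v'} → B ≤ fuel + D u' v' → Aligned u' u v v' → Resolver
      resolver-after-step : ∀ fuel {u' v' y z} → B ≤ fuel + D u' v' → Aligned y u v z →
                            D y z ≡ suc (D u' v') → Resolver

      resolver-along fuel {u'} {v'} bound al with u' ∈? W | v' ∈? W
      ... | yes u'∈W | _ = u' , u'∈W , resolverˡ al
      ... | no _ | yes v'∈W = v' , v'∈W , resolverʳ al
      ... | no u'∉W | no v'∉W with escape u' v' u'∉W v'∉W (ends-distinct al)
      ...   | inj₁ (y , adj , away) = resolver-after-step fuel bound (aligned-extend al adj away)
                                        (trans (D-sym y v') (trans away (cong suc (D-sym v' u'))))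
      ...   | inj₂ (y , adj , away) = resolver-after-step fuel bound
                                        (aligned-reverse (aligned-extend (aligned-reverse al) adj away)) away

      resolver-after-step zero {y = y} {z} bound _ grown =
        ⊥-elim (1+n≰n (≤-trans (≤-reflexive (sym grown)) (≤-trans (D≤B y z) bound)))
      resolver-after-step (suc fuel) {u'} {v'} bound al grown =
        resolver-along fuel (subst (B ≤_) (trans (sym (+-suc fuel (D u' v'))) (cong (fuel +_) (sym grown))) bound) al

    isStrongResolvingSet : StrongResolvingSet G W
    isStrongResolvingSet u v u≢v = resolver-along u≢v B (m≤m+n B (D u v)) (sym trivial)
      where
        trivial : D u u + D u v + D v v ≡ D u v
        trivial = trans (cong₂ (λ a b → a + D u v + b) (D-self u) (D-self v)) (+-identityʳ (D u v))

if-T : ∀ {A : Set} {b : Bool} {x y : A} → T b → (if b then x else y) ≡ x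
if-T {b = true} _ = refl

if-¬T : ∀ {A : Set} {b : Bool} {x y : A} → ¬ T b → (if b then x else y) ≡ y
if-¬T {b = true} n = ⊥-elim (n tt)
if-¬T {b = false} _ = refl

≤⇒≡+ : ∀ {m n} → m ≤ n → Σ ℕ λ k → n ≡ m + k
≤⇒≡+ {m} {n} le = n ∸ m , sym (m+[n∸m]≡n le)

-- Positions 0 … 2h on a cycle of length N = 2h + 1: fwd r p is the offset from r to p
-- in the direction of next, and norm turns an offset into a distance.
module OddCycle (h : ℕ) (h≥1 : 1 ≤ h) where
  N : ℕ
  N = suc (h + h)

  next : ℕ → ℕ
  next p = if suc p ≡ᵇ N then 0 else suc p

  prev : ℕ → ℕ
  prev zero = h + h
  prev (suc p) = p

  next-< : ∀ {p} → suc p < N → next p ≡ suc p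
  next-< {p} lt = if-¬T (λ t → <-irrefl (≡ᵇ⇒≡ (suc p) N t) lt)

  next-wrap : ∀ {p} → suc p ≡ N → next p ≡ 0
  next-wrap {p} e = if-T (≡⇒≡ᵇ (suc p) N e)

  next-cases : ∀ p → p < N → (suc p < N × next p ≡ suc p) ⊎ (suc p ≡ N × next p ≡ 0)
  next-cases p lt with m≤n⇒m<n∨m≡n lt
  ... | inj₁ l = inj₁ (l , next-< l)
  ... | inj₂ e = inj₂ (e , next-wrap e)

  next<N : ∀ {p} → p < N → next p < N
  next<N {p} lt with next-cases p lt
  ... | inj₁ (l , e) = subst (_< N) (sym e) l
  ... | inj₂ (_ , e) = subst (_< N) (sym e) (s≤s z≤n)

  prev<N : ∀ {p} → p < N → prev p < N
  prev<N {zero} lt = ≤-refl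
  prev<N {suc p} lt = <-trans (n<1+n p) lt

  next-prev : ∀ {p} → p < N → next (prev p) ≡ p
  next-prev {zero} lt = next-wrap refl
  next-prev {suc p} lt = next-< lt

  prev-next : ∀ {p} → p < N → prev (next p) ≡ p
  prev-next {p} lt with next-cases p lt
  ... | inj₁ (l , e) rewrite e = refl
  ... | inj₂ (e' , e) rewrite e = sym (suc-injective e')

  fwd : ℕ → ℕ → ℕ
  fwd r p = if r ≤ᵇ p then p ∸ r else N ∸ r + p

  fwd-≤ : ∀ {r p} → r ≤ p → fwd r p ≡ p ∸ r
  fwd-≤ le = if-T (≤⇒≤ᵇ le)

  fwd-> : ∀ {r p} → p < r → fwd r p ≡ N ∸ r + p
  fwd-> {r} {p} lt = if-¬T (λ t → <-irrefl refl (<-≤-trans lt (≤ᵇ⇒≤ r p t)))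

  fwd-self : ∀ r → fwd r r ≡ 0
  fwd-self r = trans (fwd-≤ {r} {r} ≤-refl) (n∸n≡0 r)

  fwd<N : ∀ {r p} → r < N → p < N → fwd r p < N
  fwd<N {r} {p} rl pl with ≤-<-connex r p
  ... | inj₁ le = subst (_< N) (sym (fwd-≤ le)) (≤-<-trans (m∸n≤m p r) pl)
  ... | inj₂ lt = subst (_< N) (sym (fwd-> lt)) lemma
    where
      lemma : N ∸ r + p < N
      lemma with ≤⇒≡+ (<⇒≤ rl)
      ... | a , ea = subst₂ _<_ (sym e1) (trans (+-comm a r) (sym ea)) (+-monoʳ-< a lt)
        where
          e1 : N ∸ r + p ≡ a + p
          e1 = cong (_+ p) (trans (cong (_∸ r) ea) (m+n∸m≡n r a))

  fwd-next : ∀ {r p} → r < N → p < N → fwd r (next p) ≡ next (fwd r p)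
  fwd-next {r} {p} rl pl with next-cases p pl
  ... | inj₁ (l , e) rewrite e with ≤-<-connex r p
  ...   | inj₁ le = begin
            fwd r (suc p) ≡⟨ fwd-≤ (m≤n⇒m≤1+n le) ⟩
            suc p ∸ r ≡⟨ +-∸-assoc 1 le ⟩
            suc (p ∸ r) ≡⟨ sym (next-< (≤-<-trans (s≤s (m∸n≤m p r)) l)) ⟩
            next (p ∸ r) ≡⟨ cong next (sym (fwd-≤ le)) ⟩
            next (fwd r p) ∎
    where open ≡-Reasoning
  ...   | inj₂ lt with m≤n⇒m<n∨m≡n lt
  ...     | inj₂ refl = begin
            fwd (suc p) (suc p) ≡⟨ fwd-self (suc p) ⟩
            0 ≡⟨ sym (next-wrap (trans (sym (+-suc (N ∸ suc p) p)) (m∸n+n≡m (<⇒≤ rl)))) ⟩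
            next (N ∸ suc p + p) ≡⟨ cong next (sym (fwd-> lt)) ⟩
            next (fwd (suc p) p) ∎
    where open ≡-Reasoning
  ...     | inj₁ lt2 = begin
            fwd r (suc p) ≡⟨ fwd-> lt2 ⟩
            N ∸ r + suc p ≡⟨ +-suc (N ∸ r) p ⟩
            suc (N ∸ r + p) ≡⟨ sym (next-< bound) ⟩
            next (N ∸ r + p) ≡⟨ cong next (sym (fwd-> lt)) ⟩
            next (fwd r p) ∎
    where
      open ≡-Reasoning
      bound : suc (N ∸ r + p) < N
      bound = subst₂ _<_ (+-suc (N ∸ r) p) (m∸n+n≡m (<⇒≤ rl)) (+-monoʳ-< (N ∸ r) lt2)
  fwd-next {zero} {p} rl pl | inj₂ (e' , e) rewrite e = refl
  fwd-next {suc r} {p} rl pl | inj₂ (e' , e) rewrite e = begin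
            fwd (suc r) 0 ≡⟨ fwd-> {suc r} {0} (s≤s z≤n) ⟩
            N ∸ suc r + 0 ≡⟨ +-identityʳ _ ⟩
            N ∸ suc r ≡⟨ cong (_∸ suc r) (sym e') ⟩
            suc p ∸ suc r ≡⟨ +-∸-assoc 1 rp ⟩
            suc (p ∸ suc r) ≡⟨ sym (next-< bound) ⟩
            next (p ∸ suc r) ≡⟨ cong next (sym (fwd-≤ rp)) ⟩
            next (fwd (suc r) p) ∎
    where
      open ≡-Reasoning
      rp : suc r ≤ p
      rp = ≤-pred (subst (suc r <_) (sym e') rl)
      bound : suc (p ∸ suc r) < N
      bound = subst (_< N) (+-∸-assoc 1 rp) (subst (λ z → z ∸ suc r < N) (sym e') (∸-monoʳ-< {N} {suc r} {0} (s≤s z≤n) (<⇒≤ rl)))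

  next-injective : ∀ {a b} → a < N → b < N → next a ≡ next b → a ≡ b
  next-injective {a} {b} al bl e = trans (sym (prev-next al)) (trans (cong prev e) (prev-next bl))

  fwd-prev : ∀ {r p} → r < N → p < N → fwd r (prev p) ≡ prev (fwd r p)
  fwd-prev {r} {p} rl pl = next-injective (fwd<N rl (prev<N pl)) (prev<N (fwd<N rl pl))
     (trans (sym (fwd-next rl (prev<N pl))) (trans (cong (fwd r) (next-prev pl)) (sym (next-prev (fwd<N rl pl)))))

  fwd≡0⇒≡ : ∀ {r p} → r < N → p < N → fwd r p ≡ 0 → r ≡ p
  fwd≡0⇒≡ {r} {p} rl pl e with ≤-<-connex r p
  ... | inj₁ le = ≤-antisym le (m∸n≡0⇒m≤n (trans (sym (fwd-≤ le)) e))
  ... | inj₂ lt = ⊥-elim (<-irrefl refl (<-≤-trans rl (m∸n≡0⇒m≤n (m+n≡0⇒m≡0 (N ∸ r) (trans (sym (fwd-> lt)) e)))))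

  fwd+fwd≡N : ∀ {r p} → r < N → p < N → r ≢ p → fwd r p + fwd p r ≡ N
  fwd+fwd≡N {r} {p} rl pl ne with <-cmp r p
  ... | tri≈ _ e _ = ⊥-elim (ne e)
  ... | tri< lt _ _ with ≤⇒≡+ (<⇒≤ lt) | ≤⇒≡+ (<⇒≤ pl)
  ...   | a , ea | b , eb = begin
            fwd r p + fwd p r ≡⟨ cong₂ _+_ (fwd-≤ (<⇒≤ lt)) (fwd-> lt) ⟩
            p ∸ r + (N ∸ p + r) ≡⟨ cong₂ (λ x y → x + (y + r)) (trans (cong (_∸ r) ea) (m+n∸m≡n r a)) (trans (cong (_∸ p) eb) (m+n∸m≡n p b)) ⟩
            a + (b + r) ≡⟨ solve-∀-helper a b r ⟩
            r + a + b ≡⟨ cong (_+ b) (sym ea) ⟩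
            p + b ≡⟨ sym eb ⟩
            N ∎
    where
      open ≡-Reasoning
      solve-∀-helper : ∀ a b r → a + (b + r) ≡ r + a + b
      solve-∀-helper = solve-∀
  fwd+fwd≡N {r} {p} rl pl ne | tri> _ _ lt with ≤⇒≡+ (<⇒≤ lt) | ≤⇒≡+ (<⇒≤ rl)
  ...   | a , ea | b , eb = begin
            fwd r p + fwd p r ≡⟨ cong₂ _+_ (fwd-> lt) (fwd-≤ (<⇒≤ lt)) ⟩
            N ∸ r + p + (r ∸ p) ≡⟨ cong₂ (λ x y → x + p + y) (trans (cong (_∸ r) eb) (m+n∸m≡n r b)) (trans (cong (_∸ p) ea) (m+n∸m≡n p a)) ⟩
            b + p + a ≡⟨ solve-∀-helper b p a ⟩
            p + a + b ≡⟨ cong (_+ b) (sym ea) ⟩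
            r + b ≡⟨ sym eb ⟩
            N ∎
    where
      open ≡-Reasoning
      solve-∀-helper : ∀ b p a → b + p + a ≡ p + a + b
      solve-∀-helper = solve-∀

  fwd-swap : ∀ {r p} → r < N → p < N → r ≢ p → fwd p r ≡ N ∸ fwd r p
  fwd-swap {r} {p} rl pl ne = sym (trans (cong (_∸ fwd r p) (sym (fwd+fwd≡N rl pl ne))) (m+n∸m≡n (fwd r p) (fwd p r)))

  norm : ℕ → ℕ
  norm d = d ⊓ (N ∸ d)

  data View (d : ℕ) : Set where
    lo : d ≤ h → View d
    hi : ∀ e f → e + suc f ≡ h → d ≡ suc (h + e) → View d

  view : ∀ d → d < N → View d
  view d dl with d ≤? h
  ... | yes le = lo le
  ... | no nle with ≤⇒≡+ (≰⇒> nle)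
  ...   | e , ee with ≤⇒≡+ el
    where
      el : suc e ≤ h
      el = +-cancelˡ-< (suc h) e h (subst (_< suc h + h) ee dl)
  ...     | f , ef = hi e f (trans (+-suc e f) (sym ef)) ee

  norm-≤h : ∀ {d} → d ≤ h → norm d ≡ d
  norm-≤h {d} le = m≤n⇒m⊓n≡m (m+n≤o⇒m≤o∸n d (≤-trans (+-mono-≤ le le) (n≤1+n (h + h))))

  N∸>h : ∀ {e f} → e + suc f ≡ h → N ∸ suc (h + e) ≡ suc f
  N∸>h {e} {f} eh = begin
        (h + h) ∸ (h + e) ≡⟨ [m+n]∸[m+o]≡n∸o h h e ⟩
        h ∸ e ≡⟨ cong (_∸ e) (sym eh) ⟩
        e + suc f ∸ e ≡⟨ m+n∸m≡n e (suc f) ⟩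
        suc f ∎
        where open ≡-Reasoning

  norm->h : ∀ {e f} → e + suc f ≡ h → norm (suc (h + e)) ≡ suc f
  norm->h {e} {f} eh = trans (m≥n⇒m⊓n≡n le) (N∸>h eh)
    where
      le : N ∸ suc (h + e) ≤ suc (h + e)
      le = subst (_≤ suc (h + e)) (sym (N∸>h eh)) (≤-trans (subst (suc f ≤_) eh (m≤n+m (suc f) e)) (≤-trans (m≤m+n h e) (n≤1+n _)))

  norm≤h : ∀ {d} → d < N → norm d ≤ h
  norm≤h {d} dl with view d dl
  ... | lo le = subst (_≤ h) (sym (norm-≤h le)) le
  ... | hi e f eh refl = subst (_≤ h) (sym (norm->h eh)) (subst (suc f ≤_) eh (m≤n+m (suc f) e))

  norm≡0⇒≡0 : ∀ {d} → d < N → norm d ≡ 0 → d ≡ 0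
  norm≡0⇒≡0 {d} dl z with view d dl
  ... | lo le = trans (sym (norm-≤h le)) z
  ... | hi e f eh refl = ⊥-elim (1+n≢0 (trans (sym (norm->h eh)) z))

  1+[h-1]≡h : 0 + suc (pred h) ≡ h
  1+[h-1]≡h = suc-pred h ⦃ >-nonZero h≥1 ⦄

  1+h<N : suc h < N
  1+h<N = s≤s (subst (_≤ h + h) (+-comm h 1) (+-monoʳ-≤ h h≥1))

  norm-next-<h : ∀ {d} → d < h → norm (next d) ≡ suc (norm d)
  norm-next-<h {d} lt = trans (cong norm (next-< (≤-<-trans lt (s≤s (m≤m+n h h))))) (trans (norm-≤h lt) (cong suc (sym (norm-≤h (<⇒≤ lt)))))

  norm-next-h : norm (next h) ≡ norm h
  norm-next-h = trans (cong norm (trans (next-< 1+h<N) (cong suc (sym (+-identityʳ h))))) (trans (norm->h 1+[h-1]≡h) (trans 1+[h-1]≡h (sym (norm-≤h ≤-refl))))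

  norm-next->h : ∀ {e f} → e + suc f ≡ h → suc (norm (next (suc (h + e)))) ≡ norm (suc (h + e))
  norm-next->h {e} {zero} eh = trans (cong (λ z → suc (norm z)) (next-wrap e1)) (trans (cong suc (norm-≤h z≤n)) (sym (norm->h eh)))
    where
      e1 : suc (suc (h + e)) ≡ N
      e1 = cong suc (trans (sym (+-suc h e)) (cong (h +_) (trans (+-comm 1 e) eh)))
  norm-next->h {e} {suc f} eh = trans (cong (λ z → suc (norm z)) (trans (next-< lt) (cong suc (sym (+-suc h e))))) (trans (cong suc (norm->h eh')) (sym (norm->h eh)))
    where
      eh' : suc e + suc f ≡ h
      eh' = trans (sym (+-suc e (suc f))) eh
      lt : suc (suc (h + e)) < N
      lt = s≤s (subst (_< h + h) (+-suc h e) (+-monoʳ-< h (subst (suc e <_) eh' (m<m+n (suc e) z<s))))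

  norm-next-≤ : ∀ {d} → d < N → norm (next d) ≤ suc (norm d)
  norm-next-≤ {d} dl with view d dl
  ... | hi e f eh refl = ≤-trans (n≤1+n _) (≤-trans (≤-reflexive (norm-next->h eh)) (n≤1+n _))
  ... | lo le with m≤n⇒m<n∨m≡n le
  ...   | inj₁ lt = ≤-reflexive (norm-next-<h lt)
  ...   | inj₂ refl = ≤-trans (≤-reflexive norm-next-h) (n≤1+n _)

  norm-≤-next : ∀ {d} → d < N → norm d ≤ suc (norm (next d))
  norm-≤-next {d} dl with view d dl
  ... | hi e f eh refl = ≤-reflexive (sym (norm-next->h eh))
  ... | lo le with m≤n⇒m<n∨m≡n le
  ...   | inj₁ lt = ≤-trans (n≤1+n _) (≤-trans (≤-reflexive (sym (norm-next-<h lt))) (n≤1+n _))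
  ...   | inj₂ refl = ≤-trans (≤-reflexive (sym norm-next-h)) (n≤1+n _)

  norm-descent : ∀ {d k} → d < N → norm d ≡ suc k → (norm (next d) ≡ k) ⊎ (norm (prev d) ≡ k)
  norm-descent {d} {k} dl e with view d dl
  ... | hi e' f eh refl = inj₁ (suc-injective (trans (norm-next->h eh) e))
  norm-descent {zero} {k} dl e | lo le = ⊥-elim (1+n≢0 (trans (sym e) (norm-≤h le)))
  norm-descent {suc d} {k} dl e | lo le = inj₂ (trans (norm-≤h (≤-trans (n≤1+n d) le)) (suc-injective (trans (sym (norm-≤h le)) e)))

  norm-ascent : ∀ {d} → d < N → norm d < h → (norm (next d) ≡ suc (norm d)) ⊎ (norm (prev d) ≡ suc (norm d))
  norm-ascent {d} dl lt with view d dl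
  ... | lo le = inj₁ (norm-next-<h (subst (_< h) (norm-≤h le) lt))
  ... | hi zero f eh refl = ⊥-elim (<-irrefl eh (subst (_< h) (norm->h eh) lt))
  ... | hi (suc e) f eh refl = inj₂ (trans (cong norm (+-suc h e)) (trans (norm->h eh') (cong suc (sym (norm->h eh)))))
    where
      eh' : e + suc (suc f) ≡ h
      eh' = trans (+-suc e (suc f)) eh

  norm-complement : ∀ {d} → 0 < d → d < N → norm (N ∸ d) ≡ norm d
  norm-complement {d} pos dl with view d dl
  ... | hi e f eh refl = trans (cong norm (N∸>h eh)) (trans (norm-≤h (subst (suc f ≤_) eh (m≤n+m (suc f) e))) (sym (norm->h eh)))
  norm-complement {suc d'} pos dl | lo le with ≤⇒≡+ le
  ...   | g , eg = trans (cong norm e1) (trans (norm->h eg') (sym (norm-≤h le)))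
    where
      eg' : g + suc d' ≡ h
      eg' = trans (+-comm g (suc d')) (sym eg)
      e1 : N ∸ suc d' ≡ suc (h + g)
      e1 = begin
        (h + h) ∸ d' ≡⟨ cong (λ z → (z + h) ∸ d') eg ⟩
        (suc d' + g + h) ∸ d' ≡⟨ cong (_∸ d') (solve-∀-helper d' g h) ⟩
        (d' + suc (g + h)) ∸ d' ≡⟨ m+n∸m≡n d' _ ⟩
        suc (g + h) ≡⟨ cong suc (+-comm g h) ⟩
        suc (h + g) ∎
        where
          open ≡-Reasoning
          solve-∀-helper : ∀ d g h → suc d + g + h ≡ d + suc (g + h)
          solve-∀-helper = solve-∀

  cycDist : ℕ → ℕ → ℕ
  cycDist r p = norm (fwd r p)

  cycDist-self : ∀ r → cycDist r r ≡ 0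
  cycDist-self r = trans (cong norm (fwd-self r)) (norm-≤h z≤n)

  cycDist-sym : ∀ {r p} → r < N → p < N → cycDist r p ≡ cycDist p r
  cycDist-sym {r} {p} rl pl with r ≟ p
  ... | yes refl = refl
  ... | no ne = sym (trans (cong norm (fwd-swap rl pl ne)) (norm-complement pos (fwd<N rl pl)))
    where
      pos : 0 < fwd r p
      pos = ≤∧≢⇒< z≤n (λ z → ne (fwd≡0⇒≡ rl pl (sym z)))

  cycDist≡0⇒≡ : ∀ {r p} → r < N → p < N → cycDist r p ≡ 0 → r ≡ p
  cycDist≡0⇒≡ rl pl z = fwd≡0⇒≡ rl pl (norm≡0⇒≡0 (fwd<N rl pl) z)

  cycDist≤h : ∀ {r p} → r < N → p < N → cycDist r p ≤ h
  cycDist≤h rl pl = norm≤h (fwd<N rl pl)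

  cycDist-next-≤ : ∀ {r p} → r < N → p < N → cycDist r (next p) ≤ suc (cycDist r p)
  cycDist-next-≤ {r} {p} rl pl = subst (λ z → norm z ≤ suc (cycDist r p)) (sym (fwd-next rl pl)) (norm-next-≤ (fwd<N rl pl))

  cycDist-≤-next : ∀ {r p} → r < N → p < N → cycDist r p ≤ suc (cycDist r (next p))
  cycDist-≤-next {r} {p} rl pl = subst (λ z → cycDist r p ≤ suc (norm z)) (sym (fwd-next rl pl)) (norm-≤-next (fwd<N rl pl))

  cycDist-descent : ∀ {r p k} → r < N → p < N → cycDist r p ≡ suc k → (cycDist r (next p) ≡ k) ⊎ (cycDist r (prev p) ≡ k)
  cycDist-descent {r} {p} rl pl e with norm-descent (fwd<N rl pl) e
  ... | inj₁ x = inj₁ (trans (cong norm (fwd-next rl pl)) x)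
  ... | inj₂ x = inj₂ (trans (cong norm (fwd-prev rl pl)) x)

  cycDist-ascent : ∀ {r p} → r < N → p < N → cycDist r p < h → (cycDist r (next p) ≡ suc (cycDist r p)) ⊎ (cycDist r (prev p) ≡ suc (cycDist r p))
  cycDist-ascent {r} {p} rl pl lt with norm-ascent (fwd<N rl pl) lt
  ... | inj₁ x = inj₁ (trans (cong norm (fwd-next rl pl)) x)
  ... | inj₂ x = inj₂ (trans (cong norm (fwd-prev rl pl)) x)

  fwd-+ : ∀ r d → fwd r (r + d) ≡ d
  fwd-+ r d = trans (fwd-≤ (m≤m+n r d)) (m+n∸m≡n r d)

  cycDist-+ : ∀ r d → d ≤ h → cycDist r (r + d) ≡ d
  cycDist-+ r d le = trans (cong norm (fwd-+ r d)) (norm-≤h le)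

  cycDist-+>h : ∀ r {e f} → e + suc f ≡ h → cycDist r (r + suc (h + e)) ≡ suc f
  cycDist-+>h r eh = trans (cong norm (fwd-+ r _)) (norm->h eh)

unique-concat-tabulate : ∀ {A : Set} {N} (f : Fin N → List A) (key : A → ℕ) →
                         (∀ i → All (λ a → key a ≡ toℕ i) (f i)) → (∀ i → Unique (f i)) →
                         Unique (concat (tabulate f))
unique-concat-tabulate {N = zero} f key keyed unique = []
unique-concat-tabulate {N = suc N} f key keyed unique =
  UP.++⁺ (unique zero) (unique-concat-tabulate (f ∘ suc) (pred ∘ key) keyed' (unique ∘ suc)) disjoint
  where
    keyed' : ∀ i → All (λ a → pred (key a) ≡ toℕ i) (f (suc i))
    keyed' i = All.map (cong pred) (keyed (suc i))
    later-nonzero : All (λ a → key a ≢ 0) (concat (tabulate (f ∘ suc)))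
    later-nonzero = AllP.concat⁺ (AllP.tabulate⁺ (λ i → All.map (λ e z → 1+n≢0 (trans (sym e) z)) (keyed (suc i))))
    disjoint : ∀ {v} → v ∈ f zero × v ∈ concat (tabulate (f ∘ suc)) → ⊥
    disjoint (v∈first , v∈rest) = All.lookup later-nonzero v∈rest (All.lookup (keyed zero) v∈first)

ΣF : ∀ {N} → (Fin N → ℕ) → ℕ
ΣF f = sum (tabulate f)

length-concat-tabulate : ∀ {A : Set} {N} (f : Fin N → List A) →
                         length (concat (tabulate f)) ≡ ΣF (length ∘ f)
length-concat-tabulate {N = zero} f = refl
length-concat-tabulate {N = suc N} f =
  trans (length-++ (f zero)) (cong (length (f zero) +_) (length-concat-tabulate (f ∘ suc)))

ΣF-mono : ∀ {N} (f g : Fin N → ℕ) → (∀ i → f i ≤ g i) → ΣF f ≤ ΣF g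
ΣF-mono {zero} f g le = z≤n
ΣF-mono {suc N} f g le = +-mono-≤ (le zero) (ΣF-mono (f ∘ suc) (g ∘ suc) (le ∘ suc))

ΣF-cong : ∀ {N} (f g : Fin N → ℕ) → (∀ i → f i ≡ g i) → ΣF f ≡ ΣF g
ΣF-cong f g e = ≤-antisym (ΣF-mono f g (≤-reflexive ∘ e)) (ΣF-mono g f (≤-reflexive ∘ sym ∘ e))

ΣF-+ : ∀ {N} (f g : Fin N → ℕ) → ΣF (λ i → f i + g i) ≡ ΣF f + ΣF g
ΣF-+ {zero} f g = refl
ΣF-+ {suc N} f g =
  trans (cong (f zero + g zero +_) (ΣF-+ (f ∘ suc) (g ∘ suc))) (+-CS.interchange (f zero) (g zero) _ _)

ΣF-zero : ∀ {N} (f : Fin N → ℕ) → (∀ i → f i ≡ 0) → ΣF f ≡ 0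
ΣF-zero {zero} f z = refl
ΣF-zero {suc N} f z = cong₂ _+_ (z zero) (ΣF-zero (f ∘ suc) (z ∘ suc))

ΣF-single : ∀ {N} (f : Fin N → ℕ) (j : Fin N) → (∀ i → i ≢ j → f i ≡ 0) → ΣF f ≡ f j
ΣF-single f zero z = trans (cong (f zero +_) (ΣF-zero (f ∘ suc) (λ i → z (suc i) (λ ())))) (+-identityʳ _)
ΣF-single f (suc j) z =
  cong₂ _+_ (z zero (λ ())) (ΣF-single (f ∘ suc) j (λ i i≢j → z (suc i) (i≢j ∘ Fin.suc-injective)))

ΣF-snoc : ∀ {N} (f : Fin (suc N) → ℕ) → ΣF f ≡ ΣF (f ∘ inject₁) + f (fromℕ N)
ΣF-snoc {zero} f = +-comm (f zero) 0
ΣF-snoc {suc N} f = trans (cong (f zero +_) (ΣF-snoc (f ∘ suc))) (sym (+-assoc (f zero) _ _))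

ΣF-suc : ∀ {N} (f : Fin N → ℕ) → ΣF (suc ∘ f) ≡ N + ΣF f
ΣF-suc {zero} f = refl
ΣF-suc {suc N} f = cong suc (begin
  f zero + ΣF (suc ∘ f ∘ suc)  ≡⟨ cong (f zero +_) (ΣF-suc (f ∘ suc)) ⟩
  f zero + (N + ΣF (f ∘ suc))  ≡⟨ +-CS.x∙yz≈y∙xz (f zero) N _ ⟩
  N + (f zero + ΣF (f ∘ suc))  ∎)
  where open ≡-Reasoning

Σr : ℕ → ℕ → (ℕ → ℕ) → ℕ
Σr a zero g = 0
Σr a (suc l) g = g a + Σr (suc a) l g

Σr-toℕ : ∀ N a (g : ℕ → ℕ) → ΣF {N} (λ i → g (a + toℕ i)) ≡ Σr a N g
Σr-toℕ zero a g = refl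
Σr-toℕ (suc N) a g = cong₂ _+_ (cong g (+-identityʳ a))
  (trans (ΣF-cong {N} _ _ (λ i → cong g (+-suc a (toℕ i)))) (Σr-toℕ N (suc a) g))

Σr-split : ∀ a l₁ l₂ (g : ℕ → ℕ) → Σr a (l₁ + l₂) g ≡ Σr a l₁ g + Σr (a + l₁) l₂ g
Σr-split a zero l₂ g = cong (λ b → Σr b l₂ g) (sym (+-identityʳ a))
Σr-split a (suc l₁) l₂ g = trans
  (cong (g a +_) (trans (Σr-split (suc a) l₁ l₂ g) (cong (λ b → Σr (suc a) l₁ g + Σr b l₂ g) (sym (+-suc a l₁)))))
  (sym (+-assoc (g a) _ _))

Σr-snoc : ∀ a l (g : ℕ → ℕ) → Σr a (suc l) g ≡ Σr a l g + g (a + l)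
Σr-snoc a l g = trans (cong (λ l' → Σr a l' g) (+-comm 1 l)) (trans (Σr-split a l 1 g) (cong (Σr a l g +_) (+-identityʳ _)))

Σr-const : ∀ a l c (g : ℕ → ℕ) → (∀ j → j < l → g (a + j) ≡ c) → Σr a l g ≡ l * c
Σr-const a zero c g e = refl
Σr-const a (suc l) c g e = cong₂ _+_ (trans (cong g (sym (+-identityʳ a))) (e 0 z<s))
  (Σr-const (suc a) l c g (λ j j<l → trans (cong g (sym (+-suc a j))) (e (suc j) (s<s j<l))))

Σr-mono : ∀ a l (f g : ℕ → ℕ) → (∀ j → j < l → f (a + j) ≤ g (a + j)) → Σr a l f ≤ Σr a l g
Σr-mono a zero f g le = z≤n
Σr-mono a (suc l) f g le = +-mono-≤ (subst (λ b → f b ≤ g b) (+-identityʳ a) (le 0 z<s))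
  (Σr-mono (suc a) l f g (λ j j<l → subst (λ b → f b ≤ g b) (+-suc a j) (le (suc j) (s<s j<l))))

Σr-cong : ∀ a l (f g : ℕ → ℕ) → (∀ j → j < l → f (a + j) ≡ g (a + j)) → Σr a l f ≡ Σr a l g
Σr-cong a l f g e = ≤-antisym (Σr-mono a l f g (λ j j<l → ≤-reflexive (e j j<l)))
                              (Σr-mono a l g f (λ j j<l → ≤-reflexive (sym (e j j<l))))

Σr-+ : ∀ a l (f g : ℕ → ℕ) → Σr a l (λ j → f j + g j) ≡ Σr a l f + Σr a l g
Σr-+ a zero f g = refl
Σr-+ a (suc l) f g = trans (cong (f a + g a +_) (Σr-+ (suc a) l f g)) (+-CS.interchange (f a) (g a) _ _)

Σr-shift : ∀ a b l (g : ℕ → ℕ) → Σr a l (λ j → g (b + j)) ≡ Σr (b + a) l g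
Σr-shift a b zero g = refl
Σr-shift a b (suc l) g = cong (g (b + a) +_) (trans (Σr-shift (suc a) b l g) (cong (λ c → Σr c l g) (+-suc b a)))

Σr-shift1 : ∀ l (g : ℕ → ℕ) → Σr 1 l g ≡ Σr 0 l (g ∘ suc)
Σr-shift1 l g = sym (Σr-shift 0 1 l g)

[_] : Bool → ℕ
[ true ] = 1
[ false ] = 0

[T]≡1 : ∀ {b} → T b → [ b ] ≡ 1
[T]≡1 {true} _ = refl

[¬T]≡0 : ∀ {b} → ¬ T b → [ b ] ≡ 0
[¬T]≡0 {true} ¬t = ⊥-elim (¬t _)
[¬T]≡0 {false} _ = refl

[b]≤1 : ∀ b → [ b ] ≤ 1
[b]≤1 true = s≤s z≤n
[b]≤1 false = z≤n

[b]≤[a∨b] : ∀ a b → [ b ] ≤ [ a ∨ b ]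
[b]≤[a∨b] true b = [b]≤1 b
[b]≤[a∨b] false b = ≤-refl

[a∨b]≤[a]+[b] : ∀ a b → [ a ∨ b ] ≤ [ a ] + [ b ]
[a∨b]≤[a]+[b] true b = s≤s z≤n
[a∨b]≤[a]+[b] false b = ≤-refl

[T∧b]≡[b] : ∀ {a} b → T a → [ a ∧ b ] ≡ [ b ]
[T∧b]≡[b] {true} b _ = refl

[T∨b]≡1 : ∀ {a} b → T a → [ a ∨ b ] ≡ 1
[T∨b]≡1 {true} b _ = refl

¬T-∧ : ∀ {a b} → ¬ T (a ∧ b) → ¬ T a ⊎ ¬ T b
¬T-∧ {false} _ = inj₁ λ ()
¬T-∧ {true} ¬b = inj₂ ¬b

¬T-∨ : ∀ {a b} → ¬ T (a ∨ b) → ¬ T a × ¬ T b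
¬T-∨ ¬a∨b = ¬a∨b ∘ from T-∨ ∘ inj₁ , ¬a∨b ∘ from T-∨ ∘ inj₂

-- α₀ β₀ α₁ β₁ … is a path with edges αⱼβⱼ and βⱼαⱼ₊₁, whose chosen vertices
-- (where α, β are true) cover every edge.
cover-evenPath : ∀ r (α β : ℕ → Bool) → (∀ j → j ≤ r → T (α j ∨ β j)) → (∀ j → j < r → T (β j ∨ α (suc j))) →
                 suc r + [ α 0 ∧ β r ] ≤ Σr 0 (suc r) (λ j → [ α j ] + [ β j ])
cover-evenPath zero α β cover₁ cover₂ with α 0 | β 0 | cover₁ 0 z≤n
... | true | true | _ = s≤s (s≤s z≤n)
... | true | false | _ = s≤s z≤n
... | false | true | _ = s≤s z≤n
cover-evenPath (suc r) α β cover₁ cover₂ =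
  subst (suc (suc r) + [ α 0 ∧ β (suc r) ] ≤_) (cong ([ α 0 ] + [ β 0 ] +_) (sym (Σr-shift1 (suc r) chosen))) first-edge
  where
    chosen : ℕ → ℕ
    chosen j = [ α j ] + [ β j ]
    rest = Σr 0 (suc r) (chosen ∘ suc)
    ih : suc r + [ α 1 ∧ β (suc r) ] ≤ rest
    ih = cover-evenPath r (α ∘ suc) (β ∘ suc) (λ j j≤r → cover₁ (suc j) (s≤s j≤r)) (λ j j<r → cover₂ (suc j) (s<s j<r))
    first-edge : suc (suc r) + [ α 0 ∧ β (suc r) ] ≤ [ α 0 ] + [ β 0 ] + rest
    first-edge with α 0 | β 0 | cover₁ 0 z≤n | cover₂ 0 z<s
    ... | true | true | _ | _ = begin
      suc (suc r) + [ β (suc r) ] ≤⟨ +-monoʳ-≤ (suc (suc r)) ([b]≤1 (β (suc r))) ⟩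
      suc (suc r) + 1             ≡⟨ +-comm (suc (suc r)) 1 ⟩
      2 + suc r                   ≤⟨ +-monoʳ-≤ 2 (≤-trans (m≤m+n (suc r) _) ih) ⟩
      2 + rest                    ∎
      where open ≤-Reasoning
    ... | true | false | _ | α₁∨β₁ = s≤s (subst (λ x → suc r + x ≤ rest) ([T∧b]≡[b] (β (suc r)) α₁∨β₁) ih)
    ... | false | true | _ | _ = s≤s (≤-trans (≤-reflexive (+-identityʳ (suc r))) (≤-trans (m≤m+n (suc r) _) ih))

-- The same for the path α₀ β₀ α₁ … βᵣ₋₁ αᵣ.
cover-oddPath : ∀ r (α β : ℕ → Bool) → (∀ j → j < r → T (α j ∨ β j)) → (∀ j → j < r → T (β j ∨ α (suc j))) →
                r + [ α 0 ∨ α r ] ≤ Σr 0 (suc r) (λ j → [ α j ]) + Σr 0 r (λ j → [ β j ])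
cover-oddPath zero α β cover₁ cover₂ with α 0
... | true = s≤s z≤n
... | false = z≤n
cover-oddPath (suc r) α β cover₁ cover₂ = subst (suc r + [ α 0 ∨ α (suc r) ] ≤_)
  (cong₂ (λ x y → ([ α 0 ] + x) + ([ β 0 ] + y)) (sym (Σr-shift1 (suc r) (λ j → [ α j ]))) (sym (Σr-shift1 r (λ j → [ β j ]))))
  first-edge
  where
    restα = Σr 0 (suc r) (λ j → [ α (suc j) ])
    restβ = Σr 0 r (λ j → [ β (suc j) ])
    ih : r + [ α 1 ∨ α (suc r) ] ≤ restα + restβ
    ih = cover-oddPath r (α ∘ suc) (β ∘ suc) (λ j j<r → cover₁ (suc j) (s<s j<r)) (λ j j<r → cover₂ (suc j) (s<s j<r))
    first-edge : suc r + [ α 0 ∨ α (suc r) ] ≤ [ α 0 ] + restα + ([ β 0 ] + restβ)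
    first-edge with α 0 | β 0 | cover₁ 0 z<s | cover₂ 0 z<s
    ... | true | true | _ | _ =
      ≤-trans (≤-reflexive (+-comm (suc r) 1)) (s≤s (≤-trans (s≤s (≤-trans (m≤m+n r _) ih)) (≤-reflexive (sym (+-suc restα restβ)))))
    ... | true | false | _ | α₁∨β₁ = s≤s (subst (λ x → r + x ≤ restα + restβ) ([T∨b]≡1 (α (suc r)) α₁∨β₁) ih)
    ... | false | true | _ | _ =
      ≤-trans (s≤s (≤-trans (+-monoʳ-≤ r ([b]≤[a∨b] (α 1) (α (suc r)))) ih)) (≤-reflexive (sym (+-suc restα restβ)))

count-1≤q≤H : ∀ H → Σr 0 (suc (H + H)) (λ q → [ (1 ≤ᵇ q) ∧ (q ≤ᵇ H) ]) ≡ H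
count-1≤q≤H H = begin
  Σr 1 (H + H) g            ≡⟨ Σr-split 1 H H g ⟩
  Σr 1 H g + Σr (1 + H) H g ≡⟨ cong₂ _+_ (Σr-const 1 H 1 g (λ j j<H → [T]≡1 (≤⇒≤ᵇ j<H)))
                                         (Σr-const (1 + H) H 0 g (λ j _ → [¬T]≡0 (above j ∘ proj₂ ∘ to T-∧))) ⟩
  H * 1 + H * 0             ≡⟨ cong₂ _+_ (*-identityʳ H) (*-zeroʳ H) ⟩
  H + 0                     ≡⟨ +-identityʳ H ⟩
  H                         ∎
  where
    open ≡-Reasoning
    g : ℕ → ℕ
    g q = [ (1 ≤ᵇ q) ∧ (q ≤ᵇ H) ]
    above : ∀ j → ¬ T (suc (H + j) ≤ᵇ H)
    above j t = <-irrefl refl (≤-trans (≤ᵇ⇒≤ _ _ t) (m≤m+n H j))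

count-H≤q : ∀ H → Σr 0 (suc (H + H)) (λ q → [ H ≤ᵇ q ]) ≡ suc H
count-H≤q H = begin
  Σr 0 (suc (H + H)) g      ≡⟨ cong (λ l → Σr 0 l g) (sym (+-suc H H)) ⟩
  Σr 0 (H + suc H) g        ≡⟨ Σr-split 0 H (suc H) g ⟩
  Σr 0 H g + Σr H (suc H) g ≡⟨ cong₂ _+_ (Σr-const 0 H 0 g (λ j j<H → [¬T]≡0 (<⇒≱ j<H ∘ ≤ᵇ⇒≤ _ _)))
                                         (Σr-const H (suc H) 1 g (λ j _ → [T]≡1 (≤⇒≤ᵇ (m≤m+n H j)))) ⟩
  H * 0 + suc H * 1         ≡⟨ cong₂ _+_ (*-zeroʳ H) (*-identityʳ (suc H)) ⟩
  suc H                     ∎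
  where
    open ≡-Reasoning
    g : ℕ → ℕ
    g q = [ H ≤ᵇ q ]

count-q≡H∨H+2≤q : ∀ H → 1 ≤ H → Σr 0 (suc (H + H)) (λ q → [ (q ≡ᵇ H) ∨ (suc (suc H) ≤ᵇ q) ]) ≡ H
count-q≡H∨H+2≤q H@(suc h') _ = begin
  Σr 0 (suc (H + H)) g                                   ≡⟨ cong (λ l → Σr 0 l g) (sym (+-suc H H)) ⟩
  Σr 0 (H + (1 + (1 + h'))) g                            ≡⟨ Σr-split 0 H (1 + (1 + h')) g ⟩
  Σr 0 H g + (g H + (g (suc H) + Σr (suc (suc H)) h' g)) ≡⟨ cong₂ _+_ (Σr-const 0 H 0 g (λ j j<H → [¬T]≡0 (below j j<H)))
                                                             (cong₂ _+_ ([T]≡1 (from T-∨ (inj₁ (≡⇒≡ᵇ H H refl))))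
                                                               (cong₂ _+_ ([¬T]≡0 just-above)
                                                                 (Σr-const (suc (suc H)) h' 1 g
                                                                   (λ j _ → [T]≡1 (from T-∨ (inj₂ (≤⇒≤ᵇ (m≤m+n (suc (suc H)) j)))))))) ⟩
  H * 0 + (1 + (0 + h' * 1))                             ≡⟨ cong₂ (λ x y → x + (1 + y)) (*-zeroʳ H) (*-identityʳ h') ⟩
  H                                                      ∎
  where
    open ≡-Reasoning
    g : ℕ → ℕ
    g q = [ (q ≡ᵇ H) ∨ (suc (suc H) ≤ᵇ q) ]
    neither : ∀ {a b} → ¬ T a → ¬ T b → ¬ T (a ∨ b)
    neither ¬a ¬b = [ ¬a , ¬b ]′ ∘ to T-∨
    below : ∀ j → j < H → ¬ T ((0 + j ≡ᵇ H) ∨ (suc (suc H) ≤ᵇ 0 + j))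
    below j j<H = neither (<⇒≢ j<H ∘ ≡ᵇ⇒≡ _ _) (λ t → <-asym j<H (<-trans (n<1+n H) (≤ᵇ⇒≤ _ _ t)))
    just-above : ¬ T ((suc H ≡ᵇ H) ∨ (suc (suc H) ≤ᵇ suc H))
    just-above = neither (<⇒≢ (n<1+n H) ∘ sym ∘ ≡ᵇ⇒≡ (suc H) H) (<-irrefl refl ∘ ≤ᵇ⇒≤ (suc (suc H)) (suc H))

module ChainCycle (k : ℕ) (n : Fin (suc (suc k)) → ℕ) (n-odd : ∀ i → n i % 2 ≡ 1) (n≥5 : ∀ i → 5 ≤ n i) where
  m : ℕ
  m = suc (suc k)

  h : Fin m → ℕ
  h i = n i / 2

  n≡1+2h : ∀ i → n i ≡ suc (h i + h i)
  n≡1+2h i = trans (m≡m%n+[m/n]*n (n i) 2) (cong₂ _+_ (n-odd i) (trans (*-comm (h i) 2) (cong (h i +_) (+-identityʳ (h i)))))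

  h≥1 : ∀ i → 1 ≤ h i
  h≥1 i with h i | n≡1+2h i | n≥5 i
  ... | suc _ | _ | _ = s≤s z≤n
  ... | zero | n≡1 | n≥5 with subst (5 ≤_) n≡1 n≥5
  ...   | s≤s ()

  [n+1]/2≡1+h : ∀ i → (n i + 1) / 2 ≡ suc (h i)
  [n+1]/2≡1+h i = trans (cong (_/ 2) e) (m*n/n≡m (suc (h i)) 2)
    where
      1+2x+1≡[1+x]*2 : ∀ x → suc (x + x) + 1 ≡ suc x * 2
      1+2x+1≡[1+x]*2 = solve-∀
      e : n i + 1 ≡ suc (h i) * 2
      e = trans (cong (_+ 1) (n≡1+2h i)) (1+2x+1≡[1+x]*2 (h i))

  module C (i : Fin m) = OddCycle (h i) (h≥1 i)

  cdist : Fin m → ℕ → ℕ → ℕ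
  cdist i = C.cycDist i

  toℕ<N : ∀ {i} (a : Fin (n i)) → toℕ a < C.N i
  toℕ<N {i} a = subst (toℕ a <_) (n≡1+2h i) (toℕ<n a)

  -- gap a b is the sum of h over the cycles strictly between a and b (hℕ extends h by 0).
  hℕ : ℕ → ℕ
  hℕ s with s <? m
  ... | yes lt = h (fromℕ< lt)
  ... | no _ = 0

  hℕ-toℕ : ∀ i → hℕ (toℕ i) ≡ h i
  hℕ-toℕ i with toℕ i <? m
  ... | yes lt = cong h (fromℕ<-toℕ i lt)
  ... | no nlt = ⊥-elim (nlt (toℕ<n i))

  Σh : ℕ → ℕ → ℕ
  Σh lo zero = 0
  Σh lo (suc l) = hℕ lo + Σh (suc lo) l

  gap : ℕ → ℕ → ℕ
  gap a b = Σh (suc a) (b ∸ suc a)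

  -- From z, a vertex of cycle t is reached through the entry vertex of t: its first vertex
  -- from an earlier cycle, its exit vertex h t + 1 from a later one.
  entry : DU m n → Fin m → ℕ
  entry (i , c) t with <-cmp (toℕ i) (toℕ t)
  ... | tri< _ _ _ = 0
  ... | tri≈ _ _ _ = toℕ c
  ... | tri> _ _ _ = suc (h t)

  entryDist : DU m n → Fin m → ℕ
  entryDist (i , c) t with <-cmp (toℕ i) (toℕ t)
  ... | tri< _ _ _ = cdist i (toℕ c) (suc (h i)) + gap (toℕ i) (toℕ t)
  ... | tri≈ _ _ _ = 0
  ... | tri> _ _ _ = gap (toℕ t) (toℕ i) + cdist i 0 (toℕ c)

  dist : DU m n → DU m n → ℕ
  dist z (t , p) = entryDist z t + cdist t (entry z t) (toℕ p)

  module _ {i t : Fin m} {c : Fin (n i)} where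
    entry-< : toℕ i < toℕ t → entry (i , c) t ≡ 0
    entry-< lt with <-cmp (toℕ i) (toℕ t)
    ... | tri< _ _ _ = refl
    ... | tri≈ nl _ _ = ⊥-elim (nl lt)
    ... | tri> nl _ _ = ⊥-elim (nl lt)
    entryDist-< : toℕ i < toℕ t → entryDist (i , c) t ≡ cdist i (toℕ c) (suc (h i)) + gap (toℕ i) (toℕ t)
    entryDist-< lt with <-cmp (toℕ i) (toℕ t)
    ... | tri< _ _ _ = refl
    ... | tri≈ nl _ _ = ⊥-elim (nl lt)
    ... | tri> nl _ _ = ⊥-elim (nl lt)
    entry-> : toℕ t < toℕ i → entry (i , c) t ≡ suc (h t)
    entry-> gt with <-cmp (toℕ i) (toℕ t)
    ... | tri< _ _ ng = ⊥-elim (ng gt)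
    ... | tri≈ _ _ ng = ⊥-elim (ng gt)
    ... | tri> _ _ _ = refl
    entryDist-> : toℕ t < toℕ i → entryDist (i , c) t ≡ gap (toℕ t) (toℕ i) + cdist i 0 (toℕ c)
    entryDist-> gt with <-cmp (toℕ i) (toℕ t)
    ... | tri< _ _ ng = ⊥-elim (ng gt)
    ... | tri≈ _ _ ng = ⊥-elim (ng gt)
    ... | tri> _ _ _ = refl
    entry-same : toℕ i ≡ toℕ t → entry (i , c) t ≡ toℕ c
    entry-same e with <-cmp (toℕ i) (toℕ t)
    ... | tri< _ ne _ = ⊥-elim (ne e)
    ... | tri≈ _ _ _ = refl
    ... | tri> _ ne _ = ⊥-elim (ne e)
    entryDist-same : toℕ i ≡ toℕ t → entryDist (i , c) t ≡ 0
    entryDist-same e with <-cmp (toℕ i) (toℕ t)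
    ... | tri< _ ne _ = ⊥-elim (ne e)
    ... | tri≈ _ _ _ = refl
    ... | tri> _ ne _ = ⊥-elim (ne e)

  entry<N : ∀ z t → entry z t < C.N t
  entry<N (i , c) t with <-cmp (toℕ i) (toℕ t)
  ... | tri< _ _ _ = s≤s z≤n
  ... | tri≈ _ e _ with toℕ-injective e
  ...   | refl = toℕ<N c
  entry<N (i , c) t | tri> _ _ _ = C.1+h<N t

  Σh-snoc : ∀ lo l → Σh lo (suc l) ≡ Σh lo l + hℕ (lo + l)
  Σh-snoc lo zero = trans (+-identityʳ (hℕ lo)) (cong hℕ (sym (+-identityʳ lo)))
  Σh-snoc lo (suc l) = trans (cong (hℕ lo +_) (Σh-snoc (suc lo) l))
     (trans (sym (+-assoc (hℕ lo) (Σh (suc lo) l) _)) (cong (λ z → hℕ lo + Σh (suc lo) l + hℕ z) (sym (+-suc lo l))))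

  gap-adjacent : ∀ a → gap a (suc a) ≡ 0
  gap-adjacent a = cong (Σh (suc a)) (n∸n≡0 a)

  gap-snoc : ∀ {a b} → a < b → gap a (suc b) ≡ gap a b + hℕ b
  gap-snoc {a} {b} lt with ≤⇒≡+ lt
  ... | l , refl = trans (cong (Σh (suc a)) (trans (cong (_∸ a) (sym (+-suc a l))) (m+n∸m≡n a (suc l))))
                    (trans (Σh-snoc (suc a) l) (cong (_+ hℕ (suc a + l)) (cong (Σh (suc a)) (sym (m+n∸m≡n (suc a) l)))))

  gap-cons : ∀ {a b} → suc a < b → gap a b ≡ hℕ (suc a) + gap (suc a) b
  gap-cons {a} {b} lt with ≤⇒≡+ lt
  ... | l , refl = trans (cong (Σh (suc a)) (trans (cong (_∸ a) (sym (+-suc a l))) (m+n∸m≡n a (suc l))))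
                    (cong (hℕ (suc a) +_) (cong (Σh (suc (suc a))) (sym (m+n∸m≡n a l))))

  dist-self : ∀ x → dist x x ≡ 0
  dist-self (i , c) = trans (cong₂ _+_ (entryDist-same {i} {i} {c} refl) (cong (λ r → cdist i r (toℕ c)) (entry-same {i} {i} {c} refl))) (C.cycDist-self i (toℕ c))

  dist-sym-< : ∀ {i t} (c : Fin (n i)) (p : Fin (n t)) → toℕ i < toℕ t → dist (i , c) (t , p) ≡ dist (t , p) (i , c)
  dist-sym-< {i} {t} c p lt = begin
      entryDist (i , c) t + cdist t (entry (i , c) t) (toℕ p)
        ≡⟨ cong₂ _+_ (entryDist-< {i} {t} {c} lt) (cong (λ r → cdist t r (toℕ p)) (entry-< {i} {t} {c} lt)) ⟩
      cdist i (toℕ c) (suc (h i)) + gap (toℕ i) (toℕ t) + cdist t 0 (toℕ p)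
        ≡⟨ cong (λ z → z + gap (toℕ i) (toℕ t) + cdist t 0 (toℕ p)) (C.cycDist-sym i (toℕ<N c) (C.1+h<N i)) ⟩
      cdist i (suc (h i)) (toℕ c) + gap (toℕ i) (toℕ t) + cdist t 0 (toℕ p)
        ≡⟨ +-CS.xy∙z≈yz∙x (cdist i (suc (h i)) (toℕ c)) (gap (toℕ i) (toℕ t)) (cdist t 0 (toℕ p)) ⟩
      gap (toℕ i) (toℕ t) + cdist t 0 (toℕ p) + cdist i (suc (h i)) (toℕ c)
        ≡⟨ sym (cong₂ _+_ (entryDist-> {t} {i} {p} lt) (cong (λ r → cdist i r (toℕ c)) (entry-> {t} {i} {p} lt))) ⟩
      entryDist (t , p) i + cdist i (entry (t , p) i) (toℕ c) ∎
    where open ≡-Reasoning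

  dist-sym : ∀ x y → dist x y ≡ dist y x
  dist-sym (i , c) (t , p) = go (<-cmp (toℕ i) (toℕ t))
    where
      go : Tri (toℕ i < toℕ t) (toℕ i ≡ toℕ t) (toℕ t < toℕ i) → dist (i , c) (t , p) ≡ dist (t , p) (i , c)
      go (tri< lt _ _) = dist-sym-< c p lt
      go (tri> _ _ gt) = sym (dist-sym-< p c gt)
      go (tri≈ _ e _) with toℕ-injective e
      ... | refl = trans (cong₂ _+_ (entryDist-same {i} {i} {c} refl) (cong (λ r → cdist i r (toℕ p)) (entry-same {i} {i} {c} refl)))
                  (trans (C.cycDist-sym i (toℕ<N c) (toℕ<N p))
                  (sym (cong₂ _+_ (entryDist-same {i} {i} {p} refl) (cong (λ r → cdist i r (toℕ c)) (entry-same {i} {i} {p} refl)))))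

  cdist-0-exit : ∀ t → cdist t 0 (suc (h t)) ≡ h t
  cdist-0-exit t = trans (cong (cdist t 0) (cong suc (sym (+-identityʳ (h t))))) (trans (C.cycDist-+>h t 0 (C.1+[h-1]≡h t)) (C.1+[h-1]≡h t))

  cdist-exit-0 : ∀ t → cdist t (suc (h t)) 0 ≡ h t
  cdist-exit-0 t = trans (C.cycDist-sym t (C.1+h<N t) (s≤s z≤n)) (cdist-0-exit t)

  dist-< : ∀ {i t} (c : Fin (n i)) (p : Fin (n t)) → toℕ i < toℕ t →
          dist (i , c) (t , p) ≡ cdist i (toℕ c) (suc (h i)) + gap (toℕ i) (toℕ t) + cdist t 0 (toℕ p)
  dist-< {i} {t} c p lt = cong₂ _+_ (entryDist-< {i} {t} {c} lt) (cong (λ r → cdist t r (toℕ p)) (entry-< {i} {t} {c} lt))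

  dist-> : ∀ {i t} (c : Fin (n i)) (p : Fin (n t)) → toℕ t < toℕ i →
          dist (i , c) (t , p) ≡ gap (toℕ t) (toℕ i) + cdist i 0 (toℕ c) + cdist t (suc (h t)) (toℕ p)
  dist-> {i} {t} c p gt = cong₂ _+_ (entryDist-> {i} {t} {c} gt) (cong (λ r → cdist t r (toℕ p)) (entry-> {i} {t} {c} gt))

  dist-same : ∀ {i} (c p : Fin (n i)) → dist (i , c) (i , p) ≡ cdist i (toℕ c) (toℕ p)
  dist-same {i} c p = cong₂ _+_ (entryDist-same {i} {i} {c} refl) (cong (λ r → cdist i r (toℕ p)) (entry-same {i} {i} {c} refl))

  dist-glued-exit : ∀ z {t t'} (a : Fin (n t')) (b : Fin (n t)) →
                    toℕ t' ≡ suc (toℕ t) → toℕ a ≡ 0 → toℕ b ≡ suc (h t) → dist z (t' , a) ≡ dist z (t , b)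
  dist-glued-exit (i , c) {t} {t'} a b t'≡1+t a≡0 b≡exit = by-position (<-cmp (toℕ i) (toℕ t))
    where
      open ≡-Reasoning
      a-from-first : cdist t' 0 (toℕ a) ≡ 0
      a-from-first = trans (cong (cdist t' 0) a≡0) (C.cycDist-self t' 0)
      a-from-exit : cdist t' (suc (h t')) (toℕ a) ≡ h t'
      a-from-exit = trans (cong (cdist t' (suc (h t'))) a≡0) (cdist-exit-0 t')
      b-from-first : cdist t 0 (toℕ b) ≡ h t
      b-from-first = trans (cong (cdist t 0) b≡exit) (cdist-0-exit t)
      b-from-exit : cdist t (suc (h t)) (toℕ b) ≡ 0
      b-from-exit = trans (cong (cdist t (suc (h t))) b≡exit) (C.cycDist-self t (suc (h t)))
      by-position : Tri (toℕ i < toℕ t) (toℕ i ≡ toℕ t) (toℕ t < toℕ i) → dist (i , c) (t' , a) ≡ dist (i , c) (t , b)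
      by-position (tri< i<t _ _) = begin
        dist (i , c) (t' , a)                          ≡⟨ dist-< c a (subst (toℕ i <_) (sym t'≡1+t) (m<n⇒m<1+n i<t)) ⟩
        A + gap (toℕ i) (toℕ t') + cdist t' 0 (toℕ a)  ≡⟨ cong₂ (λ x y → A + x + y) gap-t' a-from-first ⟩
        A + (gap (toℕ i) (toℕ t) + h t) + 0           ≡⟨ trans (+-identityʳ _) (sym (+-assoc A _ _)) ⟩
        A + gap (toℕ i) (toℕ t) + h t                 ≡⟨ cong (A + gap (toℕ i) (toℕ t) +_) (sym b-from-first) ⟩
        A + gap (toℕ i) (toℕ t) + cdist t 0 (toℕ b)   ≡⟨ sym (dist-< c b i<t) ⟩
        dist (i , c) (t , b)                          ∎
        where
          A = cdist i (toℕ c) (suc (h i))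
          gap-t' : gap (toℕ i) (toℕ t') ≡ gap (toℕ i) (toℕ t) + h t
          gap-t' = trans (cong (gap (toℕ i)) t'≡1+t) (trans (gap-snoc i<t) (cong (gap (toℕ i) (toℕ t) +_) (hℕ-toℕ t)))
      by-position (tri≈ _ i≡t _) with toℕ-injective i≡t
      ... | refl = begin
        dist (i , c) (t' , a)                          ≡⟨ dist-< c a (subst (toℕ i <_) (sym t'≡1+t) (n<1+n _)) ⟩
        A + gap (toℕ i) (toℕ t') + cdist t' 0 (toℕ a)  ≡⟨ cong₂ (λ x y → A + x + y) gap-t' a-from-first ⟩
        A + 0 + 0                                     ≡⟨ trans (+-identityʳ _) (+-identityʳ _) ⟩
        A                                             ≡⟨ cong (cdist i (toℕ c)) (sym b≡exit) ⟩
        cdist i (toℕ c) (toℕ b)                       ≡⟨ sym (dist-same c b) ⟩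
        dist (i , c) (i , b)                          ∎
        where
          A = cdist i (toℕ c) (suc (h i))
          gap-t' : gap (toℕ i) (toℕ t') ≡ 0
          gap-t' = trans (cong (gap (toℕ i)) t'≡1+t) (gap-adjacent (toℕ i))
      by-position (tri> _ _ t<i) with m≤n⇒m<n∨m≡n (subst (_≤ toℕ i) (sym t'≡1+t) t<i)
      ... | inj₁ t'<i = begin
        dist (i , c) (t' , a)                                  ≡⟨ dist-> c a t'<i ⟩
        gap (toℕ t') (toℕ i) + B + cdist t' (suc (h t')) (toℕ a) ≡⟨ cong (gap (toℕ t') (toℕ i) + B +_) a-from-exit ⟩
        gap (toℕ t') (toℕ i) + B + h t'                        ≡⟨ +-CS.xy∙z≈z∙xy (gap (toℕ t') (toℕ i)) B (h t') ⟩
        h t' + (gap (toℕ t') (toℕ i) + B)                      ≡⟨ sym (trans (+-identityʳ _) (+-assoc (h t') _ _)) ⟩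
        h t' + gap (toℕ t') (toℕ i) + B + 0                    ≡⟨ cong₂ (λ x y → x + B + y) (sym gap-t) (sym b-from-exit) ⟩
        gap (toℕ t) (toℕ i) + B + cdist t (suc (h t)) (toℕ b)   ≡⟨ sym (dist-> c b t<i) ⟩
        dist (i , c) (t , b)                                   ∎
        where
          B = cdist i 0 (toℕ c)
          gap-t : gap (toℕ t) (toℕ i) ≡ h t' + gap (toℕ t') (toℕ i)
          gap-t = trans (gap-cons (subst (_< toℕ i) t'≡1+t t'<i))
                        (cong₂ _+_ (trans (cong hℕ (sym t'≡1+t)) (hℕ-toℕ t')) (cong (λ x → gap x (toℕ i)) (sym t'≡1+t)))
      ... | inj₂ t'≡i with toℕ-injective t'≡i
      ...   | refl = begin
        dist (t' , c) (t' , a)                                               ≡⟨ dist-same c a ⟩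
        cdist t' (toℕ c) (toℕ a)                                             ≡⟨ cong (cdist t' (toℕ c)) a≡0 ⟩
        cdist t' (toℕ c) 0                                                   ≡⟨ C.cycDist-sym t' (toℕ<N c) z<s ⟩
        cdist t' 0 (toℕ c)                                                   ≡⟨ sym (+-identityʳ _) ⟩
        0 + cdist t' 0 (toℕ c) + 0                                           ≡⟨ cong₂ (λ x y → x + cdist t' 0 (toℕ c) + y) (sym gap-t') (sym b-from-exit) ⟩
        gap (toℕ t) (toℕ t') + cdist t' 0 (toℕ c) + cdist t (suc (h t)) (toℕ b) ≡⟨ sym (dist-> c b t<i) ⟩
        dist (t' , c) (t , b)                                                ∎
        where
          gap-t' : gap (toℕ t) (toℕ t') ≡ 0
          gap-t' = trans (cong (gap (toℕ t)) t'≡1+t) (gap-adjacent (toℕ t))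

  dist-glued : ∀ {x u} → Glued m n x u → ∀ z → dist z x ≡ dist z u
  dist-glued (inj₁ refl) z = refl
  dist-glued {t' , a} {t , b} (inj₂ (et , ea , eb)) z = dist-glued-exit z a b et ea (trans eb ([n+1]/2≡1+h t))

  cycStep⇒next : ∀ {t} (a b : Fin (n t)) → CycStep m n a b → toℕ b ≡ C.next t (toℕ a)
  cycStep⇒next {t} a b (inj₁ e) = trans e (sym (C.next-< t (subst (_< C.N t) e (toℕ<N b))))
  cycStep⇒next {t} a b (inj₂ (e1 , e2)) = trans e2 (sym (C.next-wrap t (trans e1 (n≡1+2h t))))

  next⇒cycStep : ∀ {t} (a b : Fin (n t)) → toℕ b ≡ C.next t (toℕ a) → CycStep m n a b
  next⇒cycStep {t} a b e with C.next-cases t (toℕ a) (toℕ<N a)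
  ... | inj₁ (_ , e') = inj₁ (trans e e')
  ... | inj₂ (e1 , e') = inj₂ (trans e1 (sym (n≡1+2h t)) , trans e e')

  fromℕ<N : ∀ {t} (x : ℕ) → x < C.N t → Fin (n t)
  fromℕ<N {t} x lt = fromℕ< (subst (x <_) (sym (n≡1+2h t)) lt)

  toℕ-fromℕ<N : ∀ {t} x (lt : x < C.N t) → toℕ (fromℕ<N {t} x lt) ≡ x
  toℕ-fromℕ<N {t} x lt = toℕ-fromℕ< _

  CycNbr : ∀ {t} → Fin (n t) → Fin (n t) → Set
  CycNbr a b = CycStep m n a b ⊎ CycStep m n b a

  nbr-next : ∀ {t} (a : Fin (n t)) → Σ (Fin (n t)) λ b → CycNbr a b × toℕ b ≡ C.next t (toℕ a)
  nbr-next {t} a = b , inj₁ (next⇒cycStep a b e) , e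
    where
      b = fromℕ<N {t} (C.next t (toℕ a)) (C.next<N t (toℕ<N a))
      e = toℕ-fromℕ<N {t} _ (C.next<N t (toℕ<N a))

  nbr-prev : ∀ {t} (a : Fin (n t)) → Σ (Fin (n t)) λ b → CycNbr a b × toℕ b ≡ C.prev t (toℕ a)
  nbr-prev {t} a = b , inj₂ (next⇒cycStep b a (trans (sym (C.next-prev t (toℕ<N a))) (cong (C.next t) (sym e)))) , e
    where
      b = fromℕ<N {t} (C.prev t (toℕ a)) (C.prev<N t (toℕ<N a))
      e = toℕ-fromℕ<N {t} _ (C.prev<N t (toℕ<N a))

  dist-lipschitz : ∀ z {x y} → DUAdj m n x y → dist z y ≤ suc (dist z x)
  dist-lipschitz z {t , a} {.t , b} (refl , inj₁ s) =
    subst (λ q → entryDist z t + cdist t (entry z t) q ≤ suc (entryDist z t + cdist t (entry z t) (toℕ a))) (sym (cycStep⇒next a b s))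
      (subst (entryDist z t + cdist t (entry z t) (C.next t (toℕ a)) ≤_) (+-suc (entryDist z t) _) (+-monoʳ-≤ (entryDist z t) (C.cycDist-next-≤ t (entry<N z t) (toℕ<N a))))
  dist-lipschitz z {t , a} {.t , b} (refl , inj₂ s) =
    subst (λ q → entryDist z t + cdist t (entry z t) (toℕ b) ≤ suc (entryDist z t + cdist t (entry z t) q)) (sym (cycStep⇒next b a s))
      (subst (entryDist z t + cdist t (entry z t) (toℕ b) ≤_) (+-suc (entryDist z t) _) (+-monoʳ-≤ (entryDist z t) (C.cycDist-≤-next t (entry<N z t) (toℕ<N b))))

  dist-descent : ∀ z {t} (p : Fin (n t)) {k'} → cdist t (entry z t) (toℕ p) ≡ suc k' →
            Σ (Fin (n t)) λ q → CycNbr p q × dist z (t , q) ≡ entryDist z t + k'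
  dist-descent z {t} p e with C.cycDist-descent t (entry<N z t) (toℕ<N p) e
  ... | inj₁ e' with nbr-next p
  ...   | q , nb , eq = q , nb , cong (entryDist z t +_) (trans (cong (cdist t (entry z t)) eq) e')
  dist-descent z {t} p e | inj₂ e' with nbr-prev p
  ...   | q , nb , eq = q , nb , cong (entryDist z t +_) (trans (cong (cdist t (entry z t)) eq) e')

  dist-ascent : ∀ z {t} (p : Fin (n t)) → cdist t (entry z t) (toℕ p) < h t →
            Σ (Fin (n t)) λ q → CycNbr p q × dist z (t , q) ≡ suc (dist z (t , p))
  dist-ascent z {t} p lt with C.cycDist-ascent t (entry<N z t) (toℕ<N p) lt
  ... | inj₁ e' with nbr-next p
  ...   | q , nb , eq = q , nb , trans (cong (entryDist z t +_) (trans (cong (cdist t (entry z t)) eq) e')) (+-suc _ _)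
  dist-ascent z {t} p lt | inj₂ e' with nbr-prev p
  ...   | q , nb , eq = q , nb , trans (cong (entryDist z t +_) (trans (cong (cdist t (entry z t)) eq) e')) (+-suc _ _)

  dist-max : ∀ z {t} (p : Fin (n t)) → cdist t (entry z t) (toℕ p) ≡ h t →
           ∀ q → dist z (t , q) ≤ dist z (t , p)
  dist-max z {t} p e q = +-monoʳ-≤ (entryDist z t) (subst (cdist t (entry z t) (toℕ q) ≤_) (sym e) (C.cycDist≤h t (entry<N z t) (toℕ<N q)))

  Vertex : Set
  Vertex = V (chainCycle m n)

  T-∨-nonzero : ∀ b x → x ≢ 0 → T (b ∨ not (x ≡ᵇ 0))
  T-∨-nonzero b zero ne = ⊥-elim (ne refl)
  T-∨-nonzero true (suc x) _ = tt
  T-∨-nonzero false (suc x) _ = tt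

  ¬isRep-zero : ∀ a b → a ≢ 0 → b ≡ 0 → ¬ T ((a ≡ᵇ 0) ∨ not (b ≡ᵇ 0))
  ¬isRep-zero zero b ne _ _ = ne refl
  ¬isRep-zero (suc a) .zero ne refl ()

  exit<n : ∀ t → (n t + 1) / 2 < n t
  exit<n t = subst₂ _<_ (sym ([n+1]/2≡1+h t)) (sym (n≡1+2h t)) (C.1+h<N t)

  exit : ∀ t → Fin (n t)
  exit t = fromℕ< (exit<n t)

  toℕ-exit : ∀ t → toℕ (exit t) ≡ suc (h t)
  toℕ-exit t = trans (toℕ-fromℕ< (exit<n t)) ([n+1]/2≡1+h t)

  representative : DU m n → Vertex
  representative (zero , a) = (zero , a) , tt
  representative (suc i , a) with toℕ a ≟ 0
  ... | yes _ = (inject₁ i , exit (inject₁ i)) , T-∨-nonzero _ (toℕ (exit (inject₁ i))) (λ z → 1+n≢0 (trans (sym (toℕ-exit (inject₁ i))) z))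
  ... | no ne = (suc i , a) , T-∨-nonzero _ (toℕ a) ne

  representative-glued : ∀ x → Glued m n x (proj₁ (representative x))
  representative-glued (zero , a) = inj₁ refl
  representative-glued (suc i , a) with toℕ a ≟ 0
  ... | yes e = inj₂ (cong suc (sym (toℕ-inject₁ i)) , e , toℕ-fromℕ< (exit<n (inject₁ i)))
  ... | no ne = inj₁ refl

  distV : Vertex → Vertex → ℕ
  distV u v = dist (proj₁ u) (proj₁ v)

  distV-sym : ∀ u v → distV u v ≡ distV v u
  distV-sym u v = dist-sym (proj₁ u) (proj₁ v)

  distV-self : ∀ u → distV u u ≡ 0
  distV-self u = dist-self (proj₁ u)

  distV≡0⇒≡ : ∀ u v → distV u v ≡ 0 → u ≡ v
  distV≡0⇒≡ ((i , c) , r) ((t , p) , r') z = go (<-cmp (toℕ i) (toℕ t))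
    where
      go : Tri (toℕ i < toℕ t) (toℕ i ≡ toℕ t) (toℕ t < toℕ i) → ((i , c) , r) ≡ ((t , p) , r')
      go (tri< lt _ _) = ⊥-elim (¬isRep-zero (toℕ t) (toℕ p) (λ e → <⇒≢ (≤-<-trans z≤n lt) (sym e))
                          (sym (C.cycDist≡0⇒≡ t (s≤s z≤n) (toℕ<N p) (m+n≡0⇒n≡0 _ (trans (sym (dist-< c p lt)) z)))) r')
      go (tri> _ _ gt) = ⊥-elim (¬isRep-zero (toℕ i) (toℕ c) (λ e → <⇒≢ (≤-<-trans z≤n gt) (sym e))
                          (sym (C.cycDist≡0⇒≡ i (s≤s z≤n) (toℕ<N c)
                            (m+n≡0⇒n≡0 (gap (toℕ t) (toℕ i))
                              (m+n≡0⇒m≡0 (gap (toℕ t) (toℕ i) + cdist i 0 (toℕ c)) (trans (sym (dist-> c p gt)) z))))) r)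
      go (tri≈ _ e _) with toℕ-injective e
      ... | refl with toℕ-injective (C.cycDist≡0⇒≡ i (toℕ<N c) (toℕ<N p) (trans (sym (dist-same c p)) z))
      ...   | refl = cong (λ q → ((i , c) , q)) (T-irrelevant r r')

  distV-lipschitz : ∀ z {x y} → Adj (chainCycle m n) x y → distV z y ≤ suc (distV z x)
  distV-lipschitz z {x} {y} (x' , y' , gx , gy , a) =
    subst₂ (λ p q → p ≤ suc q) (dist-glued gy (proj₁ z)) (dist-glued gx (proj₁ z)) (dist-lipschitz (proj₁ z) a)

  distV-step : ∀ z (v : Vertex) {t} (p : Fin (n t)) → Glued m n (t , p) (proj₁ v) → ∀ {k'} →
          cdist t (entry (proj₁ z) t) (toℕ p) ≡ suc k' →
          Σ Vertex λ y → Adj (chainCycle m n) v y × distV z y ≡ entryDist (proj₁ z) t + k'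
  distV-step z v {t} p g e with dist-descent (proj₁ z) p e
  ... | q , nb , eq = representative (t , q) , ((t , p) , (t , q) , g , representative-glued (t , q) , (refl , nb)) ,
                      trans (sym (dist-glued (representative-glued (t , q)) (proj₁ z))) eq

  distV-descent-within : ∀ z (v : Vertex) {t} (p : Fin (n t)) → Glued m n (t , p) (proj₁ v) → ∀ kk →
                         dist (proj₁ z) (t , p) ≡ suc kk → 0 < cdist t (entry (proj₁ z) t) (toℕ p) →
                         Σ Vertex λ y → Adj (chainCycle m n) v y × distV z y ≡ kk
  distV-descent-within z v {t} p g kk e pos = map₂ (map₂ (λ ey → trans ey shorter)) (distV-step z v p g (sym X≡1+[X-1]))
    where
      X = cdist t (entry (proj₁ z) t) (toℕ p)
      X≡1+[X-1] : suc (pred X) ≡ X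
      X≡1+[X-1] = suc-pred X ⦃ >-nonZero pos ⦄
      shorter : entryDist (proj₁ z) t + pred X ≡ kk
      shorter = suc-injective (begin
        suc (entryDist (proj₁ z) t + pred X) ≡⟨ sym (+-suc _ _) ⟩
        entryDist (proj₁ z) t + suc (pred X) ≡⟨ cong (entryDist (proj₁ z) t +_) X≡1+[X-1] ⟩
        dist (proj₁ z) (t , p)               ≡⟨ e ⟩
        suc kk                               ∎)
        where open ≡-Reasoning

  -- When v is the entry point of its cycle t seen from a later cycle, v is glued to the
  -- first vertex of cycle t + 1, and a step towards z is taken inside that cycle.
  distV-descent-via-exit : ∀ z (v : Vertex) kk → toℕ (proj₁ (proj₁ v)) < toℕ (proj₁ (proj₁ z)) →
                           entry (proj₁ z) (proj₁ (proj₁ v)) ≡ toℕ (proj₂ (proj₁ v)) →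
                           distV z v ≡ suc kk → Σ Vertex λ y → Adj (chainCycle m n) v y × distV z y ≡ kk
  distV-descent-via-exit z@((i , c) , _) v@((t , p) , _) kk t<i p-entry e =
    distV-descent-within z v first glued kk (trans (dist-glued glued (proj₁ z)) e) (n≢0⇒n>0 not-entry)
    where
      t+1<m : suc (toℕ t) < m
      t+1<m = ≤-<-trans t<i (toℕ<n i)
      t' : Fin m
      t' = fromℕ< t+1<m
      toℕ-t' : toℕ t' ≡ suc (toℕ t)
      toℕ-t' = toℕ-fromℕ< t+1<m
      first : Fin (n t')
      first = fromℕ<N {t'} 0 z<s
      toℕ-first : toℕ first ≡ 0
      toℕ-first = toℕ-fromℕ<N {t'} 0 z<s
      glued : Glued m n (t' , first) (t , p)
      glued = inj₂ (toℕ-t' , toℕ-first , trans (sym p-entry) (trans (entry-> {i} {t} {c} t<i) (sym ([n+1]/2≡1+h t))))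
      not-entry : cdist t' (entry (i , c) t') (toℕ first) ≢ 0
      not-entry eK = by-position (<-cmp (toℕ i) (toℕ t'))
        where
          open ≡-Reasoning
          by-position : Tri (toℕ i < toℕ t') (toℕ i ≡ toℕ t') (toℕ t' < toℕ i) → ⊥
          by-position (tri< i<t' _ _) = <⇒≱ i<t' (subst (_≤ toℕ i) (sym toℕ-t') t<i)
          by-position (tri≈ _ i≡t' _) = 1+n≢0 (begin
            suc kk                                                          ≡⟨ sym e ⟩
            dist (i , c) (t , p)                                            ≡⟨ sym (dist-glued glued (i , c)) ⟩
            entryDist (i , c) t' + cdist t' (entry (i , c) t') (toℕ first) ≡⟨ cong₂ _+_ (entryDist-same {i} {t'} {c} i≡t') eK ⟩
            0                                                               ∎)
          by-position (tri> _ _ t'<i) = 1+n≢0 (begin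
            suc (h t')       ≡⟨ sym (entry-> {i} {t'} {c} t'<i) ⟩
            entry (i , c) t' ≡⟨ C.cycDist≡0⇒≡ t' (entry<N (i , c) t') (toℕ<N first) eK ⟩
            toℕ first        ≡⟨ toℕ-first ⟩
            0                ∎)

  distV-descent : ∀ z v kk → distV z v ≡ suc kk → Σ Vertex λ y → Adj (chainCycle m n) v y × distV z y ≡ kk
  distV-descent z@((i , c) , _) v@((t , p) , v-rep) kk e = descend _ refl
    where
      descend : ∀ K → cdist t (entry (i , c) t) (toℕ p) ≡ K → Σ Vertex λ y → Adj (chainCycle m n) v y × distV z y ≡ kk
      descend (suc _) eK = distV-descent-within z v p (inj₁ refl) kk e (subst (0 <_) (sym eK) z<s)
      descend zero eK = by-position (<-cmp (toℕ i) (toℕ t))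
        where
          p-entry : entry (i , c) t ≡ toℕ p
          p-entry = C.cycDist≡0⇒≡ t (entry<N (i , c) t) (toℕ<N p) eK
          by-position : Tri (toℕ i < toℕ t) (toℕ i ≡ toℕ t) (toℕ t < toℕ i) →
                        Σ Vertex λ y → Adj (chainCycle m n) v y × distV z y ≡ kk
          by-position (tri< i<t _ _) = ⊥-elim (¬isRep-zero (toℕ t) (toℕ p) (<⇒≢ (≤-<-trans z≤n i<t) ∘ sym)
                                         (trans (sym p-entry) (entry-< {i} {t} {c} i<t)) v-rep)
          by-position (tri≈ _ i≡t _) = ⊥-elim (1+n≢0 (trans (sym e) (cong₂ _+_ (entryDist-same {i} {t} {c} i≡t) eK)))
          by-position (tri> _ _ t<i) = distV-descent-via-exit z v kk t<i p-entry e

  Σh-split : ∀ a b c → Σh a (b + c) ≡ Σh a b + Σh (a + b) c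
  Σh-split a zero c = cong (λ z → Σh z c) (sym (+-identityʳ a))
  Σh-split a (suc b) c = trans (cong (hℕ a +_) (trans (Σh-split (suc a) b c) (cong (λ z → Σh (suc a) b + Σh z c) (sym (+-suc a b)))))
                                (sym (+-assoc (hℕ a) _ _))

  Σh≤Σh-all : ∀ lo l → lo + l ≤ m → Σh lo l ≤ Σh 0 m
  Σh≤Σh-all lo l le with ≤⇒≡+ le
  ... | rest , e = subst (Σh lo l ≤_) (sym (trans (cong (Σh 0) e) (trans (cong (Σh 0) (+-assoc lo l rest)) (Σh-split 0 lo (l + rest)))))
                     (≤-trans (≤-trans (m≤m+n (Σh lo l) (Σh (lo + l) rest)) (≤-reflexive (sym (Σh-split lo l rest)))) (m≤n+m _ (Σh 0 lo)))

  h≤Σh-all : ∀ (i : Fin m) → h i ≤ Σh 0 m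
  h≤Σh-all i = ≤-trans (≤-reflexive (trans (sym (hℕ-toℕ i)) (sym (+-identityʳ (hℕ (toℕ i)))))) (Σh≤Σh-all (toℕ i) 1 (subst (_≤ m) (+-comm 1 (toℕ i)) (toℕ<n i)))

  dist-bound-< : ∀ {i t} (c : Fin (n i)) (p : Fin (n t)) → toℕ i < toℕ t → dist (i , c) (t , p) ≤ Σh 0 m
  dist-bound-< {i} {t} c p lt with ≤⇒≡+ lt
  ... | l , el = begin
      dist (i , c) (t , p) ≡⟨ dist-< c p lt ⟩
      cdist i (toℕ c) (suc (h i)) + gap (toℕ i) (toℕ t) + cdist t 0 (toℕ p)
        ≤⟨ +-mono-≤ (+-monoˡ-≤ (gap (toℕ i) (toℕ t)) (C.cycDist≤h i (toℕ<N c) (C.1+h<N i))) (C.cycDist≤h t (s≤s z≤n) (toℕ<N p)) ⟩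
      h i + gap (toℕ i) (toℕ t) + h t ≡⟨ cong₂ (λ x y → x + gap (toℕ i) (toℕ t) + y) (sym (hℕ-toℕ i)) (sym (hℕ-toℕ t)) ⟩
      hℕ (toℕ i) + Σh (suc (toℕ i)) (toℕ t ∸ suc (toℕ i)) + hℕ (toℕ t)
        ≡⟨ cong (λ z → hℕ (toℕ i) + Σh (suc (toℕ i)) (z ∸ suc (toℕ i)) + hℕ (toℕ t)) el ⟩
      hℕ (toℕ i) + Σh (suc (toℕ i)) (suc (toℕ i) + l ∸ suc (toℕ i)) + hℕ (toℕ t)
        ≡⟨ cong (λ z → hℕ (toℕ i) + Σh (suc (toℕ i)) z + hℕ (toℕ t)) (m+n∸m≡n (suc (toℕ i)) l) ⟩
      Σh (toℕ i) (suc l) + hℕ (toℕ t) ≡⟨ cong (λ z → Σh (toℕ i) (suc l) + hℕ z) (trans el (sym (+-suc (toℕ i) l))) ⟩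
      Σh (toℕ i) (suc l) + hℕ (toℕ i + suc l) ≡⟨ sym (Σh-snoc (toℕ i) (suc l)) ⟩
      Σh (toℕ i) (suc (suc l))
        ≤⟨ Σh≤Σh-all (toℕ i) (suc (suc l))
             (subst (_≤ m) (trans (cong suc el) (sym (trans (+-suc (toℕ i) (suc l)) (cong suc (+-suc (toℕ i) l))))) (toℕ<n t)) ⟩
      Σh 0 m ∎
    where open ≤-Reasoning

  dist≤Σh : ∀ x y → dist x y ≤ Σh 0 m
  dist≤Σh (i , c) (t , p) = go (<-cmp (toℕ i) (toℕ t))
    where
      go : Tri (toℕ i < toℕ t) (toℕ i ≡ toℕ t) (toℕ t < toℕ i) → dist (i , c) (t , p) ≤ Σh 0 m
      go (tri< lt _ _) = dist-bound-< c p lt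
      go (tri> _ _ gt) = subst (_≤ Σh 0 m) (dist-sym (t , p) (i , c)) (dist-bound-< p c gt)
      go (tri≈ _ e _) with toℕ-injective e
      ... | refl = subst (_≤ Σh 0 m) (sym (dist-same c p)) (≤-trans (C.cycDist≤h i (toℕ<N c) (toℕ<N p)) (h≤Σh-all i))

  _≟ᴰ_ : DecidableEquality (DU m n)
  _≟ᴰ_ = ≡-dec Fin._≟_ Fin._≟_

  _≟ⱽ_ : DecidableEquality Vertex
  _≟ⱽ_ = ≡-dec _≟ᴰ_ λ r r' → yes (T-irrelevant r r')

  open GraphDistance (chainCycle m n) distV distV-sym distV-self distV≡0⇒≡ distV-lipschitz distV-descent public

  NonExit : DU m n → Set
  NonExit (t , p) = (toℕ p ≢ suc (h t)) ⊎ (toℕ t ≡ suc k)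

  maximallyDistant-within : ∀ z (u : Vertex) → NonExit (proj₁ u) →
         cdist (proj₁ (proj₁ u)) (entry (proj₁ z) (proj₁ (proj₁ u))) (toℕ (proj₂ (proj₁ u))) ≡ h (proj₁ (proj₁ u)) →
         MaximallyDistant u z
  maximallyDistant-within z ((t , p) , r) ne e y (x' , y' , inj₁ refl , gy , (refl , nb)) =
    subst (_≤ dist (proj₁ z) (t , p)) (dist-glued gy (proj₁ z)) (dist-max (proj₁ z) p e _)
  maximallyDistant-within z ((t , p) , r) (inj₁ ne) e y (x' , y' , inj₂ (et , ea , eb) , gy , a) = ⊥-elim (ne (trans eb ([n+1]/2≡1+h t)))
  maximallyDistant-within z ((t , p) , r) (inj₂ last) e y ((t' , _) , y' , inj₂ (et , ea , eb) , gy , a) =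
    ⊥-elim (<-irrefl refl (subst (_< m) (trans et (cong suc last)) (toℕ<n t')))

  escape-within : ∀ z (u : Vertex) {t} (p : Fin (n t)) → Glued m n (t , p) (proj₁ u) →
         cdist t (entry (proj₁ z) t) (toℕ p) < h t →
         Escape u z
  escape-within z u {t} p g lt with dist-ascent (proj₁ z) p lt
  ... | q , nb , e = representative (t , q) , ((t , p) , (t , q) , g , representative-glued (t , q) , (refl , nb)) ,
                     trans (sym (dist-glued (representative-glued (t , q)) (proj₁ z))) (trans e (cong suc (dist-glued g (proj₁ z))))

  isRep⇒nonzero : ∀ a b → a ≢ 0 → T ((a ≡ᵇ 0) ∨ not (b ≡ᵇ 0)) → b ≢ 0
  isRep⇒nonzero a b ne r e = ¬isRep-zero a b ne e r

  chosen : Fin m → ℕ → Bool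
  chosen zero q = (1 ≤ᵇ q) ∧ (q ≤ᵇ h zero)
  chosen (suc t) q = if toℕ t ≡ᵇ k then (h (suc t) ≤ᵇ q) else ((q ≡ᵇ h (suc t)) ∨ (suc (suc (h (suc t))) ≤ᵇ q))

  chosenᴰ : DU m n → Bool
  chosenᴰ (t , p) = chosen t (toℕ p)

  chosen-nonzero : ∀ x → T (chosenᴰ x) → toℕ (proj₂ x) ≢ 0
  chosen-nonzero (zero , p) w e = <⇒≢ (≤ᵇ⇒≤ 1 (toℕ p) (proj₁ (to T-∧ w))) (sym e)
  chosen-nonzero (suc t , p) w e with toℕ t ≡ᵇ k
  ... | true = <⇒≢ (≤-trans (h≥1 (suc t)) (≤ᵇ⇒≤ _ _ w)) (sym e)
  ... | false with to (T-∨ {toℕ p ≡ᵇ h (suc t)}) w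
  ...   | inj₁ x = <⇒≢ (subst (1 ≤_) (sym (≡ᵇ⇒≡ _ _ x)) (h≥1 (suc t))) (sym e)
  ...   | inj₂ x = <⇒≢ (≤-trans (s≤s z≤n) (≤ᵇ⇒≤ _ _ x)) (sym e)

  chosen-isRep : ∀ x → T (chosenᴰ x) → T (isRep m n x)
  chosen-isRep x w = T-∨-nonzero _ _ (chosen-nonzero x w)

  IsExit IsLow IsFirstFar : DU m n → Set
  IsExit (t , p) = (toℕ p ≡ suc (h t)) × (toℕ t < suc k)
  IsLow (t , p) = (toℕ t ≢ 0) × (1 ≤ toℕ p) × (toℕ p < h t)
  IsFirstFar (t , p) = (toℕ t ≡ 0) × ((toℕ p ≡ 0) ⊎ (suc (suc (h t)) ≤ toℕ p))

  unchosen-cases : ∀ x → T (isRep m n x) → ¬ T (chosenᴰ x) → IsExit x ⊎ IsLow x ⊎ IsFirstFar x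
  unchosen-cases (zero , p) r nw with toℕ p ≟ 0
  ... | yes e = inj₂ (inj₂ (refl , inj₁ e))
  ... | no ne with ¬T-∧ {1 ≤ᵇ toℕ p} nw
  ...   | inj₁ f = ⊥-elim (f (≤⇒≤ᵇ (≤∧≢⇒< z≤n (λ e → ne (sym e)))))
  ...   | inj₂ f with m≤n⇒m<n∨m≡n (≰⇒> (λ le → f (≤⇒≤ᵇ le)))
  ...     | inj₁ lt = inj₂ (inj₂ (refl , inj₂ lt))
  ...     | inj₂ e = inj₁ (sym e , s≤s z≤n)
  unchosen-cases (suc t , p) r nw with toℕ t ≡ᵇ k in ek
  ... | true = inj₂ (inj₁ ((λ ()) , ≤∧≢⇒< z≤n (λ e → pz (sym e)) , ≰⇒> (λ le → nw (≤⇒≤ᵇ le))))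
    where pz = isRep⇒nonzero (suc (toℕ t)) (toℕ p) (λ ()) r
  ... | false with ¬T-∨ {toℕ p ≡ᵇ h (suc t)} nw
  ...   | nh' , nhi with <-cmp (toℕ p) (h (suc t))
  ...     | tri< lt _ _ = inj₂ (inj₁ ((λ ()) , ≤∧≢⇒< z≤n (λ e → pz (sym e)) , lt))
    where pz = isRep⇒nonzero (suc (toℕ t)) (toℕ p) (λ ()) r
  ...     | tri≈ _ e _ = ⊥-elim (nh' (≡⇒≡ᵇ _ _ e))
  ...     | tri> _ _ gt = inj₁ (≤-antisym (≤-pred (≰⇒> (λ le → nhi (≤⇒≤ᵇ le)))) gt , s≤s tk)
    where
      tk : toℕ t < k
      tk = ≤∧≢⇒< (≤-pred (toℕ<n t)) (λ e2 → subst T ek (≡⇒≡ᵇ _ _ e2))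

  cdist<h-close : ∀ t {a b} → a ≤ b → b < a + h t → cdist t a b < h t
  cdist<h-close t {a} {b} le lt with ≤⇒≡+ le
  ... | d , refl = subst (_< h t) (sym (C.cycDist-+ t a d (<⇒≤ dl))) dl
    where
      dl : d < h t
      dl = +-cancelˡ-< a d (h t) lt

  cdist<h-near : ∀ t {a b} → a < C.N t → b < C.N t → b < a + h t → a < b + h t → cdist t a b < h t
  cdist<h-near t {a} {b} al bl l1 l2 with ≤-total a b
  ... | inj₁ le = cdist<h-close t le l1
  ... | inj₂ le = subst (_< h t) (C.cycDist-sym t bl al) (cdist<h-close t le l2)

  cdist<h-from-0 : ∀ t {p} → suc (suc (h t)) ≤ p → p < C.N t → cdist t 0 p < h t
  cdist<h-from-0 t {p} le pl' with ≤⇒≡+ le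
  ... | e , refl with ≤⇒≡+ (+-cancelˡ-< (suc (suc (h t))) e (h t ∸ 1) el)
    where
      el : suc (suc (h t)) + e < suc (suc (h t)) + (h t ∸ 1)
      el = subst (suc (suc (h t)) + e <_) (sym eq) pl'
        where
          eq : suc (suc (h t)) + (h t ∸ 1) ≡ C.N t
          eq = cong suc (trans (sym (+-suc (h t) (h t ∸ 1))) (cong (h t +_) (m+[n∸m]≡n (h≥1 t))))
  ... | f , ef = subst (_< h t) (sym (trans (cong (cdist t 0) (cong suc (sym (+-suc (h t) e)))) (C.cycDist-+>h t 0 eh))) lt
    where
      eh : suc e + suc f ≡ h t
      eh = trans (+-suc (suc e) f) (trans (cong suc (sym ef)) (m+[n∸m]≡n (h≥1 t)))
      lt : suc f < h t
      lt = subst (suc f <_) eh (m<n+m (suc f) {suc e} (s≤s z≤n))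

  escape-exit : ∀ (u v : Vertex) → IsExit (proj₁ u) → toℕ (proj₁ (proj₁ v)) ≤ toℕ (proj₁ (proj₁ u)) →
          Escape u v
  escape-exit ((t , p) , r) v (ep , tl) le = escape-within v ((t , p) , r) a0 g lt
    where
      lt' : suc (toℕ t) < m
      lt' = s≤s tl
      t' : Fin m
      t' = fromℕ< lt'
      et : toℕ t' ≡ suc (toℕ t)
      et = toℕ-fromℕ< lt'
      a0 : Fin (n t')
      a0 = fromℕ<N {t'} 0 (s≤s z≤n)
      ea : toℕ a0 ≡ 0
      ea = toℕ-fromℕ<N {t'} 0 (s≤s z≤n)
      g : Glued m n (t' , a0) (t , p)
      g = inj₂ (et , ea , trans ep (sym ([n+1]/2≡1+h t)))
      lt : cdist t' (entry (proj₁ v) t') (toℕ a0) < h t'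
      lt = subst (_< h t') (sym (trans (cong₂ (cdist t') (entry-< {proj₁ (proj₁ v)} {t'} {proj₂ (proj₁ v)}
                                                           (subst (toℕ (proj₁ (proj₁ v)) <_) (sym et) (s≤s le))) ea)
                                       (C.cycDist-self t' 0)))
             (h≥1 t')

  escape-low : ∀ (u v : Vertex) → IsLow (proj₁ v) → toℕ (proj₁ (proj₁ u)) < toℕ (proj₁ (proj₁ v)) →
          Escape v u
  escape-low u ((t , p) , r) (_ , _ , pl') lt = escape-within u ((t , p) , r) p (inj₁ refl)
    (subst (_< h t) (sym (trans (cong (λ z → cdist t z (toℕ p)) (entry-< {proj₁ (proj₁ u)} {t} {proj₂ (proj₁ u)} lt)) (C.cycDist-+ t 0 (toℕ p) (<⇒≤ pl')))) pl')

  escape-same-cycle : ∀ (u v : Vertex) → proj₁ (proj₁ u) ≡ proj₁ (proj₁ v) →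
          cdist (proj₁ (proj₁ u)) (toℕ (proj₂ (proj₁ v))) (toℕ (proj₂ (proj₁ u))) < h (proj₁ (proj₁ u)) →
          Escape u v
  escape-same-cycle ((t , p) , r) ((.t , p') , r') refl lt = escape-within ((t , p') , r') ((t , p) , r) p (inj₁ refl)
    (subst (_< h t) (cong (λ z → cdist t z (toℕ p)) (sym (entry-same {t} {t} {p'} refl))) lt)

  <far+h : ∀ t {a b} → suc (suc (h t)) ≤ b → a < C.N t → a < b + h t
  <far+h t {a} {b} le al = <-≤-trans al (≤-trans (n≤1+n (suc (h t + h t))) (+-monoˡ-≤ (h t) le))

  cdist<h-first-cycle : ∀ t {a b} → a < C.N t → b < C.N t → (a ≡ 0 ⊎ suc (suc (h t)) ≤ a) → (b ≡ 0 ⊎ suc (suc (h t)) ≤ b) → cdist t a b < h t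
  cdist<h-first-cycle t al bl (inj₁ refl) (inj₁ refl) = subst (_< h t) (sym (C.cycDist-self t 0)) (h≥1 t)
  cdist<h-first-cycle t al bl (inj₁ refl) (inj₂ fb) = cdist<h-from-0 t fb bl
  cdist<h-first-cycle t al bl (inj₂ fa) (inj₁ refl) = subst (_< h t) (C.cycDist-sym t (s≤s z≤n) al) (cdist<h-from-0 t fa al)
  cdist<h-first-cycle t al bl (inj₂ fa) (inj₂ fb) = cdist<h-near t al bl (<far+h t fa bl) (<far+h t fb al)

  unchosen-escape : ∀ (u v : Vertex) → ¬ T (chosenᴰ (proj₁ u)) → ¬ T (chosenᴰ (proj₁ v)) →
         Escape u v ⊎ Escape v u
  unchosen-escape u@((c , p) , r) v@((c' , p') , r') nu nv =
    go (<-cmp (toℕ c) (toℕ c')) (unchosen-cases (c , p) r nu) (unchosen-cases (c' , p') r' nv)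
    where
      Cases : DU m n → Set
      Cases x = IsExit x ⊎ IsLow x ⊎ IsFirstFar x
      go : Tri (toℕ c < toℕ c') (toℕ c ≡ toℕ c') (toℕ c' < toℕ c) → Cases (c , p) → Cases (c' , p') → Escape u v ⊎ Escape v u
      go (tri< lt _ _) _ (inj₁ ev) = inj₂ (escape-exit v u ev (<⇒≤ lt))
      go (tri< lt _ _) _ (inj₂ (inj₁ lv)) = inj₂ (escape-low u v lv lt)
      go (tri< lt _ _) _ (inj₂ (inj₂ (z , _))) = ⊥-elim (n≮0 (subst (toℕ c <_) z lt))
      go (tri> _ _ gt) (inj₁ eu) _ = inj₁ (escape-exit u v eu (<⇒≤ gt))
      go (tri> _ _ gt) (inj₂ (inj₁ lu)) _ = inj₁ (escape-low v u lu gt)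
      go (tri> _ _ gt) (inj₂ (inj₂ (z , _))) _ = ⊥-elim (n≮0 (subst (toℕ c' <_) z gt))
      go (tri≈ _ e _) (inj₁ eu) _ = inj₁ (escape-exit u v eu (≤-reflexive (sym e)))
      go (tri≈ _ e _) _ (inj₁ ev) = inj₂ (escape-exit v u ev (≤-reflexive e))
      go (tri≈ _ e _) (inj₂ (inj₁ lu)) (inj₂ (inj₂ (z , _))) = ⊥-elim (proj₁ lu (trans e z))
      go (tri≈ _ e _) (inj₂ (inj₂ (z , _))) (inj₂ (inj₁ lv)) = ⊥-elim (proj₁ lv (trans (sym e) z))
      go (tri≈ _ e _) (inj₂ (inj₁ lu)) (inj₂ (inj₁ lv)) with toℕ-injective e
      ... | refl = inj₁ (escape-same-cycle u v refl (cdist<h-near c (toℕ<N p') (toℕ<N p)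
                      (<-≤-trans (proj₂ (proj₂ lu)) (m≤n+m (h c) (toℕ p')))
                      (<-≤-trans (proj₂ (proj₂ lv)) (m≤n+m (h c) (toℕ p)))))
      go (tri≈ _ e _) (inj₂ (inj₂ (_ , zu))) (inj₂ (inj₂ (_ , zv))) with toℕ-injective e
      ... | refl = inj₁ (escape-same-cycle u v refl (cdist<h-first-cycle c (toℕ<N p') (toℕ<N p) zv zu))

  cellAux : (x : DU m n) → (b : Bool) → chosenᴰ x ≡ b → List Vertex
  cellAux x true e = (x , chosen-isRep x (subst T (sym e) tt)) ∷ []
  cellAux x false e = []

  cell : DU m n → List Vertex
  cell x = cellAux x (chosenᴰ x) refl

  row : Fin m → List Vertex
  row t = concat (tabulate (λ p → cell (t , p)))

  W* : List Vertex
  W* = concat (tabulate row)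

  cell-key : ∀ x b e → All (λ a → proj₁ a ≡ x) (cellAux x b e)
  cell-key x true e = refl ∷ []
  cell-key x false e = []

  cell-unique : ∀ x b e → Unique (cellAux x b e)
  cell-unique x true e = [] ∷ []
  cell-unique x false e = []

  row-key : ∀ t → All (λ a → toℕ (proj₁ (proj₁ a)) ≡ toℕ t) (row t)
  row-key t = AllP.concat⁺ (AllP.tabulate⁺ (λ p → All.map (λ e → cong (λ x → toℕ (proj₁ x)) e) (cell-key (t , p) _ refl)))

  row-unique : ∀ t → Unique (row t)
  row-unique t = unique-concat-tabulate (λ p → cell (t , p)) (λ a → toℕ (proj₂ (proj₁ a)))
             (λ p → All.map (λ e → cong (λ x → toℕ (proj₂ x)) e) (cell-key (t , p) _ refl)) (λ p → cell-unique (t , p) _ refl)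

  W*-unique : Unique W*
  W*-unique = unique-concat-tabulate row (λ a → toℕ (proj₁ (proj₁ a))) row-key row-unique

  ∈-cell : ∀ x b (e : chosenᴰ x ≡ b) (r : T (isRep m n x)) → T b → (x , r) ∈ cellAux x b e
  ∈-cell x true e r _ = here (cong (x ,_) (T-irrelevant _ _))

  W*-complete : ∀ (u : Vertex) → T (chosenᴰ (proj₁ u)) → u ∈ W*
  W*-complete ((t , p) , r) w = ∈-concat⁺′ (∈-concat⁺′ (∈-cell (t , p) _ refl r w) (∈-tabulate⁺ {f = λ p → cell (t , p)} p)) (∈-tabulate⁺ {f = row} t)

  length-cell : ∀ x b e → length (cellAux x b e) ≡ [ b ]
  length-cell x true e = refl
  length-cell x false e = refl

  chosenCount : Fin m → ℕ
  chosenCount t = Σr 0 (n t) (λ q → [ chosen t q ])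

  length-W* : length W* ≡ ΣF chosenCount
  length-W* = trans (length-concat-tabulate row)
             (ΣF-cong _ _ (λ t → trans (length-concat-tabulate (λ p → cell (t , p)))
                 (trans (ΣF-cong _ _ (λ p → length-cell (t , p) _ refl)) (Σr-toℕ (n t) 0 (λ q → [ chosen t q ])))))

  sdimValue : ℕ
  sdimValue = suc k + n zero / 2 + n (fromℕ (suc k)) / 2 + sum (map (λ i → (n (suc (inject₁ i)) ∸ 2) / 2) (allFin k))

  Σmiddle : ℕ
  Σmiddle = ΣF (λ i → pred (h (suc (inject₁ i))))

  sdimValue≡ : sdimValue ≡ h zero + (Σmiddle + h (fromℕ (suc k))) + suc k
  sdimValue≡ = trans (cong (suc k + h zero + h (fromℕ (suc k)) +_) sum≡Σmiddle) (rearrange (suc k) (h zero) (h (fromℕ (suc k))) Σmiddle)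
    where
      sum≡Σmiddle : sum (map (λ i → (n (suc (inject₁ i)) ∸ 2) / 2) (allFin k)) ≡ Σmiddle
      sum≡Σmiddle = trans (cong sum (map-tabulate id (λ i → (n (suc (inject₁ i)) ∸ 2) / 2)))
                          (ΣF-cong _ _ (λ i → [m∸n]/n≡m/n∸1 (n (suc (inject₁ i))) 2))
      rearrange : ∀ k a b s → k + a + b + s ≡ a + (s + b) + k
      rearrange = solve-∀

  chosenCount-pointwise : ∀ t (G : ℕ → Bool) → (∀ q → chosen t q ≡ G q) → chosenCount t ≡ Σr 0 (suc (h t + h t)) (λ q → [ G q ])
  chosenCount-pointwise t G e = trans (cong (λ z → Σr 0 z (λ q → [ chosen t q ])) (n≡1+2h t))
                       (Σr-cong 0 (suc (h t + h t)) (λ q → [ chosen t q ]) (λ q → [ G q ]) (λ j _ → cong [_] (e j)))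

  chosenCount-first : chosenCount zero ≡ h zero
  chosenCount-first = trans (chosenCount-pointwise zero _ (λ q → refl)) (count-1≤q≤H (h zero))

  chosenCount-middle : ∀ (i : Fin k) → chosenCount (suc (inject₁ i)) ≡ h (suc (inject₁ i))
  chosenCount-middle i = trans (chosenCount-pointwise (suc (inject₁ i)) _ (λ q → if-¬T ne)) (count-q≡H∨H+2≤q _ (h≥1 _))
    where
      ne : ¬ T (toℕ (inject₁ i) ≡ᵇ k)
      ne w = <-irrefl (trans (sym (toℕ-inject₁ i)) (≡ᵇ⇒≡ _ _ w)) (toℕ<n i)

  chosenCount-last : chosenCount (fromℕ (suc k)) ≡ suc (h (fromℕ (suc k)))
  chosenCount-last = trans (chosenCount-pointwise (fromℕ (suc k)) _ (λ q → if-T (≡⇒≡ᵇ _ _ (toℕ-fromℕ k)))) (count-H≤q _)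

  length-W*≡sdimValue : length W* ≡ sdimValue
  length-W*≡sdimValue = begin
      length W* ≡⟨ length-W* ⟩
      ΣF chosenCount ≡⟨ cong (chosenCount zero +_) (ΣF-snoc (λ i → chosenCount (suc i))) ⟩
      chosenCount zero + (ΣF (λ i → chosenCount (suc (inject₁ i))) + chosenCount (fromℕ (suc k)))
        ≡⟨ cong₂ (λ x y → x + y) chosenCount-first (cong₂ _+_ (ΣF-cong _ _ chosenCount-middle) chosenCount-last) ⟩
      h zero + (ΣF (λ i → h (suc (inject₁ i))) + suc (h (fromℕ (suc k))))
        ≡⟨ cong (λ z → h zero + (z + suc (h (fromℕ (suc k))))) (trans (ΣF-cong _ _ (λ i → sym (C.1+[h-1]≡h (suc (inject₁ i))))) (ΣF-suc (λ i → pred (h (suc (inject₁ i)))))) ⟩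
      h zero + ((k + Σmiddle) + suc (h (fromℕ (suc k)))) ≡⟨ rearrange (h zero) k Σmiddle (h (fromℕ (suc k))) ⟩
      h zero + (Σmiddle + h (fromℕ (suc k))) + suc k ≡⟨ sym sdimValue≡ ⟩
      sdimValue ∎
    where
      open ≡-Reasoning
      rearrange : ∀ a k s b → a + ((k + s) + suc b) ≡ a + (s + b) + suc k
      rearrange = solve-∀

  W*-isStrongResolving : StrongResolvingSet (chainCycle m n) W*
  W*-isStrongResolving = EscapeCriterion.isStrongResolvingSet _≟ⱽ_ W* (Σh 0 m)
    (λ u v → dist≤Σh (proj₁ u) (proj₁ v))
    (λ u v u∉W v∉W _ → unchosen-escape u v (u∉W ∘ W*-complete u) (v∉W ∘ W*-complete v))

  memberᴰ : List Vertex → DU m n → Bool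
  memberᴰ [] x = false
  memberᴰ (w ∷ W) x = does (_≟ᴰ_ (proj₁ w) x) ∨ memberᴰ W x

  does-≟ᴰ-refl : ∀ x → T (does (_≟ᴰ_ x x))
  does-≟ᴰ-refl x with _≟ᴰ_ x x
  ... | yes _ = tt
  ... | no ne = ⊥-elim (ne refl)

  does-≟ᴰ-≢ : ∀ x y → x ≢ y → [ does (_≟ᴰ_ x y) ] ≡ 0
  does-≟ᴰ-≢ x y ne with _≟ᴰ_ x y
  ... | yes e = ⊥-elim (ne e)
  ... | no _ = refl

  ∈⇒memberᴰ : ∀ {W u} → u ∈ W → T (memberᴰ W (proj₁ u))
  ∈⇒memberᴰ {w ∷ W} (here refl) = from T-∨ (inj₁ (does-≟ᴰ-refl (proj₁ w)))
  ∈⇒memberᴰ {w ∷ W} (there mm) = from (T-∨ {does (_≟ᴰ_ (proj₁ w) _)}) (inj₂ (∈⇒memberᴰ mm))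

  ΣV : (DU m n → ℕ) → ℕ
  ΣV g = ΣF (λ t → ΣF (λ p → g (t , p)))

  ΣV-mono : ∀ f g → (∀ x → f x ≤ g x) → ΣV f ≤ ΣV g
  ΣV-mono f g le = ΣF-mono _ _ (λ t → ΣF-mono _ _ (λ p → le (t , p)))

  ΣV-+ : ∀ f g → ΣV (λ x → f x + g x) ≡ ΣV f + ΣV g
  ΣV-+ f g = trans (ΣF-cong _ _ (λ t → ΣF-+ (λ p → f (t , p)) (λ p → g (t , p))))
                   (ΣF-+ (λ t → ΣF (λ p → f (t , p))) (λ t → ΣF (λ p → g (t , p))))

  ΣV-single : ∀ x → ΣV (λ y → [ does (_≟ᴰ_ x y) ]) ≡ 1
  ΣV-single (t₀ , p₀) = trans (ΣF-single (λ t → ΣF (λ p → [ does (_≟ᴰ_ (t₀ , p₀) (t , p)) ])) t₀ outer) inner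
    where
      outer : ∀ t → t ≢ t₀ → ΣF (λ p → [ does (_≟ᴰ_ (t₀ , p₀) (t , p)) ]) ≡ 0
      outer t ne = ΣF-zero (λ p → [ does (_≟ᴰ_ (t₀ , p₀) (t , p)) ]) (λ p → does-≟ᴰ-≢ (t₀ , p₀) (t , p) (λ e → ne (sym (cong proj₁ e))))
      inner : ΣF (λ p → [ does (_≟ᴰ_ (t₀ , p₀) (t₀ , p)) ]) ≡ 1
      inner = trans (ΣF-single (λ p → [ does (_≟ᴰ_ (t₀ , p₀) (t₀ , p)) ]) p₀
                               (λ p ne → does-≟ᴰ-≢ (t₀ , p₀) (t₀ , p) (λ { refl → ne refl })))
                    ([T]≡1 (does-≟ᴰ-refl (t₀ , p₀)))

  ΣV-member≤length : ∀ W → ΣV (λ x → [ memberᴰ W x ]) ≤ length W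
  ΣV-member≤length [] = ≤-reflexive (ΣF-zero (λ t → ΣF {n t} (λ p → 0)) (λ t → ΣF-zero {n t} (λ p → 0) (λ p → refl)))
  ΣV-member≤length (w ∷ W) = begin
      ΣV (λ x → [ does (_≟ᴰ_ (proj₁ w) x) ∨ memberᴰ W x ])
        ≤⟨ ΣV-mono _ _ (λ x → [a∨b]≤[a]+[b] (does (_≟ᴰ_ (proj₁ w) x)) (memberᴰ W x)) ⟩
      ΣV (λ x → [ does (_≟ᴰ_ (proj₁ w) x) ] + [ memberᴰ W x ]) ≡⟨ ΣV-+ (λ x → [ does (_≟ᴰ_ (proj₁ w) x) ]) (λ x → [ memberᴰ W x ]) ⟩
      ΣV (λ x → [ does (_≟ᴰ_ (proj₁ w) x) ]) + ΣV (λ x → [ memberᴰ W x ]) ≤⟨ +-mono-≤ (≤-reflexive (ΣV-single (proj₁ w))) (ΣV-member≤length W) ⟩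
      suc (length W) ∎
    where open ≤-Reasoning

  0<n : ∀ t → 0 < n t
  0<n t = ≤-trans (s≤s z≤n) (n≥5 t)

  finAt : ∀ t → ℕ → Fin (n t)
  finAt t q with q <? n t
  ... | yes lt = fromℕ< lt
  ... | no _ = fromℕ< (0<n t)

  finAt-< : ∀ t q (lt : q < n t) → finAt t q ≡ fromℕ< lt
  finAt-< t q lt with q <? n t
  ... | yes _ = refl
  ... | no nl = ⊥-elim (nl lt)

  toℕ-finAt : ∀ t q → q < C.N t → toℕ (finAt t q) ≡ q
  toℕ-finAt t q lt = trans (cong toℕ (finAt-< t q lt')) (toℕ-fromℕ< lt')
    where lt' = subst (q <_) (sym (n≡1+2h t)) lt

  finAt-toℕ : ∀ t (p : Fin (n t)) → finAt t (toℕ p) ≡ p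
  finAt-toℕ t p = trans (finAt-< t (toℕ p) (toℕ<n p)) (fromℕ<-toℕ p (toℕ<n p))

  finAt-N : ∀ t → finAt t (C.N t) ≡ finAt t 0
  finAt-N t with C.N t <? n t
  ... | yes lt = ⊥-elim (<-irrefl (sym (n≡1+2h t)) lt)
  ... | no _ = sym (finAt-< t 0 (0<n t))

  memberAt : List Vertex → Fin m → ℕ → Bool
  memberAt W t q = memberᴰ W (t , finAt t q)

  ΣV-memberAt : ∀ W t → ΣF (λ p → [ memberᴰ W (t , p) ]) ≡ Σr 0 (n t) (λ q → [ memberAt W t q ])
  ΣV-memberAt W t = trans (ΣF-cong _ _ (λ p → cong (λ x → [ memberᴰ W (t , x) ]) (sym (finAt-toℕ t p))))
                     (Σr-toℕ (n t) 0 (λ q → [ memberAt W t q ]))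

  RepPos : Fin m → ℕ → Set
  RepPos t q = (q ≢ 0) ⊎ (toℕ t ≡ 0)

  NonExitPos : Fin m → ℕ → Set
  NonExitPos t q = (q ≢ suc (h t)) ⊎ (toℕ t ≡ suc k)

  T-0≡ᵇ0-∨ : ∀ a b → a ≡ 0 → T ((a ≡ᵇ 0) ∨ b)
  T-0≡ᵇ0-∨ zero b _ = tt

  isRep-finAt : ∀ t q → q < C.N t → RepPos t q → T (isRep m n (t , finAt t q))
  isRep-finAt t q lt (inj₁ nz) = T-∨-nonzero _ _ (λ e → nz (trans (sym (toℕ-finAt t q lt)) e))
  isRep-finAt t q lt (inj₂ e) = T-0≡ᵇ0-∨ (toℕ t) _ e

  nonExit-finAt : ∀ t q → q < C.N t → NonExitPos t q → NonExit (t , finAt t q)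
  nonExit-finAt t q lt (inj₁ ne) = inj₁ (λ e → ne (trans (sym (toℕ-finAt t q lt)) e))
  nonExit-finAt t q lt (inj₂ e) = inj₂ e

  pairwise-∨⇒≥ : ∀ N (f : Fin (suc N) → Bool) → (∀ i j → toℕ i < toℕ j → T (f i ∨ f j)) → N ≤ ΣF (λ i → [ f i ])
  pairwise-∨⇒≥ zero f pw = z≤n
  pairwise-∨⇒≥ (suc N) f pw with f zero in e0
  ... | true = s≤s (pairwise-∨⇒≥ N (λ i → f (suc i)) (λ i j lt → pw (suc i) (suc j) (s≤s lt)))
  ... | false = ≤-reflexive (sym (trans (ΣF-cong _ (λ _ → 1) all1) (ones (suc N))))
    where
      all1 : ∀ i → [ f (suc i) ] ≡ 1
      all1 i with pw zero (suc i) (s≤s z≤n)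
      ... | w = [T]≡1 (subst (λ b → T (b ∨ f (suc i))) e0 w)
      ones : ∀ M → ΣF {M} (λ _ → 1) ≡ M
      ones zero = refl
      ones (suc M) = cong suc (ones M)

  module LowerBound (W : List Vertex) (srs : StrongResolvingSet (chainCycle m n) W) where
    maximallyDistant-pair-in-W : ∀ (u v : Vertex) → u ≢ v →
              MaximallyDistant u v → MaximallyDistant v u →
              T (memberᴰ W (proj₁ u) ∨ memberᴰ W (proj₁ v))
    maximallyDistant-pair-in-W u v ne mu mv with srs u v ne
    ... | w , wm , res with mutuallyMaximallyDistant-resolver mu mv res
    ...   | inj₁ refl = from T-∨ (inj₁ (∈⇒memberᴰ wm))
    ...   | inj₂ refl = from (T-∨ {memberᴰ W (proj₁ u)}) (inj₂ (∈⇒memberᴰ wm))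

    antipodal-pair-in-W : ∀ t q1 q2 → q1 < C.N t → q2 < C.N t → q1 ≢ q2 → RepPos t q1 → RepPos t q2 → NonExitPos t q1 → NonExitPos t q2 →
            cdist t q2 q1 ≡ h t → T (memberAt W t q1 ∨ memberAt W t q2)
    antipodal-pair-in-W t q1 q2 l1 l2 ne r1 r2 n1 n2 e = maximallyDistant-pair-in-W u v neq
        (maximallyDistant-within v u (nonExit-finAt t q1 l1 n1)
          (trans (cong₂ (cdist t) (trans (entry-same {t} {t} {finAt t q2} refl) (toℕ-finAt t q2 l2)) (toℕ-finAt t q1 l1)) e))
        (maximallyDistant-within u v (nonExit-finAt t q2 l2 n2)
          (trans (cong₂ (cdist t) (trans (entry-same {t} {t} {finAt t q1} refl) (toℕ-finAt t q1 l1)) (toℕ-finAt t q2 l2))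
                 (trans (C.cycDist-sym t l1 l2) e)))
      where
        u v : Vertex
        u = (t , finAt t q1) , isRep-finAt t q1 l1 r1
        v = (t , finAt t q2) , isRep-finAt t q2 l2 r2
        neq : u ≢ v
        neq eq = ne (trans (sym (toℕ-finAt t q1 l1)) (trans (cong (λ x → toℕ (proj₂ (proj₁ x))) eq) (toℕ-finAt t q2 l2)))

    cross-pair-in-W : ∀ i j q1 q2 → toℕ i < toℕ j → q1 < C.N i → q2 < C.N j → RepPos i q1 → RepPos j q2 → NonExitPos i q1 → NonExitPos j q2 →
             cdist i q1 (suc (h i)) ≡ h i → cdist j 0 q2 ≡ h j → T (memberAt W i q1 ∨ memberAt W j q2)
    cross-pair-in-W i j q1 q2 lt l1 l2 r1 r2 n1 n2 e1 e2 = maximallyDistant-pair-in-W u v neq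
        (maximallyDistant-within v u (nonExit-finAt i q1 l1 n1) (trans (cong₂ (cdist i) (entry-> {j} {i} {finAt j q2} lt) (toℕ-finAt i q1 l1)) (trans (C.cycDist-sym i (C.1+h<N i) l1) e1)))
        (maximallyDistant-within u v (nonExit-finAt j q2 l2 n2) (trans (cong₂ (cdist j) (entry-< {i} {j} {finAt i q1} lt) (toℕ-finAt j q2 l2)) e2))
      where
        u v : Vertex
        u = (i , finAt i q1) , isRep-finAt i q1 l1 r1
        v = (j , finAt j q2) , isRep-finAt j q2 l2 r2
        neq : u ≢ v
        neq eq = <-irrefl (cong (λ x → toℕ (proj₁ (proj₁ x))) eq) lt

    inW : Fin m → ℕ → Bool
    inW = memberAt W

    [inW] : Fin m → ℕ → ℕ
    [inW] t q = [ inW t q ]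

    countW : Fin m → ℕ
    countW t = Σr 0 (n t) ([inW] t)

    -- Positions q and q + h + 1 are antipodal, hence mutually maximally distant; the
    -- antipodal pairs link 1, h + 2, 2, h + 3, … into a path (antipodes₁, antipodes₂).
    module AlongCycle (t : Fin m) where
      H = h t
      r = pred H
      1+r≡H : suc r ≡ H
      1+r≡H = C.1+[h-1]≡h t
      N = C.N t

      <N : ∀ {q} → q ≤ H + H → q < N
      <N le = s≤s le

      inW-N≡inW-0 : inW t N ≡ inW t 0
      inW-N≡inW-0 = cong (λ x → memberᴰ W (t , x)) (finAt-N t)

      2+j≤H : ∀ j → j < r → suc (suc j) ≤ H
      2+j≤H j lt = subst (suc (suc j) ≤_) 1+r≡H (s≤s lt)

      H+2+j≤2H : ∀ j → j < r → suc (suc H) + j ≤ H + H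
      H+2+j≤2H j lt = subst (_≤ H + H) (trans (+-suc H (suc j)) (cong suc (+-suc H j))) (+-monoʳ-≤ H (2+j≤H j lt))

      antipodes₁ : ∀ j → j < r → T (inW t (suc j) ∨ inW t (suc (suc H) + j))
      antipodes₁ j lt = antipodal-pair-in-W t (suc j) (suc (suc H) + j) (<N (≤-trans (<⇒≤ (2+j≤H j lt)) (m≤m+n H H))) (<N (H+2+j≤2H j lt))
                  (λ e → <-irrefl (cong pred e) (s≤s (m≤n+m j H)))
                  (inj₁ (λ ())) (inj₁ (λ ()))
                  (inj₁ (λ e → <-irrefl (cong pred e) (≤-trans (n≤1+n (suc j)) (2+j≤H j lt))))
                  (inj₁ (λ e → <-irrefl (cong pred (sym e)) (≤-trans (n<1+n H) (m≤m+n (suc H) j))))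
                  (trans (C.cycDist-sym t (<N (H+2+j≤2H j lt)) (<N (≤-trans (<⇒≤ (2+j≤H j lt)) (m≤m+n H H))))
                     (trans (cong (cdist t (suc j)) (antipode H j)) (trans (C.cycDist-+>h t (suc j) (C.1+[h-1]≡h t)) (C.1+[h-1]≡h t))))
        where
          antipode : ∀ H j → suc (suc H) + j ≡ suc j + suc (H + 0)
          antipode = solve-∀

      antipodes₂ : ∀ j → j < r → T (inW t (suc (suc H) + j) ∨ inW t (suc (suc j)))
      antipodes₂ j lt = antipodal-pair-in-W t (suc (suc H) + j) (suc (suc j)) (<N (H+2+j≤2H j lt)) (<N (≤-trans (2+j≤H j lt) (m≤m+n H H)))
                  (λ e → <-irrefl (sym e) (≤-<-trans (2+j≤H j lt) (≤-trans (n<1+n H) (≤-trans (n≤1+n _) (m≤m+n (suc (suc H)) j)))))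
                  (inj₁ (λ ())) (inj₁ (λ ()))
                  (inj₁ (λ e → <-irrefl (cong pred (sym e)) (≤-trans (n<1+n H) (m≤m+n (suc H) j))))
                  (inj₁ (λ e → <-irrefl e (≤-<-trans (2+j≤H j lt) (n<1+n H))))
                  (trans (cong (cdist t (suc (suc j))) (antipode H j)) (C.cycDist-+ t (suc (suc j)) H ≤-refl))
        where
          antipode : ∀ H j → suc (suc H) + j ≡ suc (suc j) + H
          antipode = solve-∀

      Sdec : ∀ a → Σr a H ([inW] t) ≡ [inW] t a + Σr (suc a) r ([inW] t)
      Sdec a = cong (λ z → Σr a z ([inW] t)) (sym 1+r≡H)

      countW-split : countW t ≡ [inW] t 0 + (Σr 1 H ([inW] t) + ([inW] t (suc H) + Σr (suc (suc H)) r ([inW] t)))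
      countW-split = begin
          Σr 0 (n t) ([inW] t) ≡⟨ cong (λ z → Σr 0 z ([inW] t)) (n≡1+2h t) ⟩
          [inW] t 0 + Σr 1 (H + H) ([inW] t) ≡⟨ cong ([inW] t 0 +_) (Σr-split 1 H H ([inW] t)) ⟩
          [inW] t 0 + (Σr 1 H ([inW] t) + Σr (suc H) H ([inW] t)) ≡⟨ cong (λ z → [inW] t 0 + (Σr 1 H ([inW] t) + z)) (Sdec (suc H)) ⟩
          [inW] t 0 + (Σr 1 H ([inW] t) + ([inW] t (suc H) + Σr (suc (suc H)) r ([inW] t))) ∎
        where open ≡-Reasoning

      Σr-from : ∀ b l → Σr 0 l (λ j → [inW] t (b + j)) ≡ Σr b l ([inW] t)
      Σr-from b l = trans (Σr-shift 0 b l ([inW] t)) (cong (λ z → Σr z l ([inW] t)) (+-identityʳ b))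

    countW-first : h zero + [ inW zero 1 ∧ inW zero 0 ] ≤ countW zero
    countW-first = subst₂ (λ x y → x + [ inW zero 1 ∧ y ] ≤ countW zero) 1+r≡H βr
                (≤-trans (cover-evenPath r α β hyp1 hyp2) sumle)
      where
        open AlongCycle zero
        α β : ℕ → Bool
        α j = inW zero (suc j)
        β j = inW zero (suc (suc H) + j)
        eN : suc (suc H) + r ≡ N
        eN = cong suc (trans (sym (+-suc H r)) (cong (H +_) 1+r≡H))
        βr : β r ≡ inW zero 0
        βr = trans (cong (inW zero) eN) inW-N≡inW-0
        hyp1 : ∀ j → j ≤ r → T (α j ∨ β j)
        hyp1 j le with m≤n⇒m<n∨m≡n le
        ... | inj₁ lt = antipodes₁ j lt
        ... | inj₂ refl = subst₂ (λ x y → T (x ∨ y)) (cong (inW zero) (sym 1+r≡H)) (sym βr)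
               (antipodal-pair-in-W zero H 0 (<N (m≤m+n H H)) (s≤s z≤n) H≢0 (inj₁ H≢0) (inj₂ refl)
                  (inj₁ (λ e → <-irrefl e (n<1+n H))) (inj₁ (λ ())) (C.cycDist-+ zero 0 H ≤-refl))
          where
            H≢0 : H ≢ 0
            H≢0 e = <-irrefl (sym e) (h≥1 zero)
        hyp2 : ∀ j → j < r → T (β j ∨ α (suc j))
        hyp2 j lt = antipodes₂ j lt
        A = Σr 1 H ([inW] zero)
        B = Σr (suc (suc H)) r ([inW] zero)
        sumle : Σr 0 (suc r) (λ j → [ α j ] + [ β j ]) ≤ countW zero
        sumle = begin
            Σr 0 (suc r) (λ j → [ α j ] + [ β j ]) ≡⟨ Σr-+ 0 (suc r) (λ j → [ α j ]) (λ j → [ β j ]) ⟩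
            Σr 0 (suc r) (λ j → [inW] zero (1 + j)) + Σr 0 (suc r) (λ j → [inW] zero (suc (suc H) + j)) ≡⟨ cong₂ _+_ (Σr-from 1 (suc r)) (Σr-from (suc (suc H)) (suc r)) ⟩
            Σr 1 (suc r) ([inW] zero) + Σr (suc (suc H)) (suc r) ([inW] zero) ≡⟨ cong₂ _+_ (cong (λ z → Σr 1 z ([inW] zero)) 1+r≡H) (Σr-snoc (suc (suc H)) r ([inW] zero)) ⟩
            A + (B + [inW] zero (suc (suc H) + r)) ≡⟨ cong (λ z → A + (B + [ z ])) βr ⟩
            A + (B + [inW] zero 0) ≡⟨ +-CS.x∙yz≈z∙xy A B _ ⟩
            [inW] zero 0 + (A + B) ≤⟨ +-monoʳ-≤ ([inW] zero 0) (+-monoʳ-≤ A (m≤n+m B _)) ⟩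
            [inW] zero 0 + (A + ([inW] zero (suc H) + B)) ≡⟨ sym countW-split ⟩
            countW zero ∎
          where open ≤-Reasoning

    countW-middle : ∀ t → pred (h t) + [ inW t 1 ∨ inW t (h t) ] ≤ countW t
    countW-middle t = subst (λ y → r + [ inW t 1 ∨ y ] ≤ countW t) (cong (inW t) 1+r≡H)
                (≤-trans (cover-oddPath r α β (λ j lt → antipodes₁ j lt) (λ j lt → antipodes₂ j lt)) sumle)
      where
        open AlongCycle t
        α β : ℕ → Bool
        α j = inW t (suc j)
        β j = inW t (suc (suc H) + j)
        A = Σr 1 H ([inW] t)
        B = Σr (suc (suc H)) r ([inW] t)
        sumle : Σr 0 (suc r) (λ j → [ α j ]) + Σr 0 r (λ j → [ β j ]) ≤ countW t
        sumle = begin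
            Σr 0 (suc r) (λ j → [inW] t (1 + j)) + Σr 0 r (λ j → [inW] t (suc (suc H) + j))
              ≡⟨ cong₂ _+_ (trans (Σr-from 1 (suc r)) (cong (λ z → Σr 1 z ([inW] t)) 1+r≡H)) (Σr-from (suc (suc H)) r) ⟩
            A + B ≤⟨ ≤-trans (+-monoʳ-≤ A (m≤n+m B _)) (m≤n+m _ ([inW] t 0)) ⟩
            [inW] t 0 + (A + ([inW] t (suc H) + B)) ≡⟨ sym countW-split ⟩
            countW t ∎
          where open ≤-Reasoning

    countW-last : ∀ t → toℕ t ≡ suc k → h t + [ inW t (suc (h t)) ∧ inW t (h t) ] ≤ countW t
    countW-last t last = subst₂ (λ x y → x + [ y ∧ inW t (h t) ] ≤ countW t) 1+r≡H (cong (inW t) (cong suc (+-identityʳ H)))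
                (subst (λ y → suc r + [ α 0 ∧ y ] ≤ countW t) (cong (inW t) 1+r≡H)
                (≤-trans (cover-evenPath r α β hyp1 hyp2) sumle))
      where
        open AlongCycle t
        α β : ℕ → Bool
        α j = inW t (suc H + j)
        β j = inW t (suc j)
        hyp1 : ∀ j → j ≤ r → T (α j ∨ β j)
        hyp1 j le = antipodal-pair-in-W t (suc H + j) (suc j) (<N p1) (<N (≤-trans sjH (m≤m+n H H)))
                      (λ e → <-irrefl (sym (cong pred e)) (m<n+m j (h≥1 t)))
                      (inj₁ (λ ())) (inj₁ (λ ())) (inj₂ last)
                      (inj₁ (λ e → <-irrefl (cong pred e) sjH))
                      (trans (cong (cdist t (suc j)) (antipode H j)) (C.cycDist-+ t (suc j) H ≤-refl))
          where
            antipode : ∀ H j → suc H + j ≡ suc j + H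
            antipode = solve-∀
            sjH : suc j ≤ H
            sjH = subst (suc j ≤_) 1+r≡H (s≤s le)
            p1 : suc H + j ≤ H + H
            p1 = subst (_≤ H + H) (+-suc H j) (+-monoʳ-≤ H sjH)
        hyp2 : ∀ j → j < r → T (β j ∨ α (suc j))
        hyp2 j lt = subst (λ z → T (inW t (suc j) ∨ inW t z)) (sym (+-suc (suc H) j)) (antipodes₁ j lt)
        A = Σr 1 H ([inW] t)
        Cc = Σr (suc H) H ([inW] t)
        countW-split₂ : countW t ≡ [inW] t 0 + (A + Cc)
        countW-split₂ = trans (cong (λ z → Σr 0 z ([inW] t)) (n≡1+2h t)) (cong ([inW] t 0 +_) (Σr-split 1 H H ([inW] t)))
        sumle : Σr 0 (suc r) (λ j → [ α j ] + [ β j ]) ≤ countW t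
        sumle = begin
            Σr 0 (suc r) (λ j → [ α j ] + [ β j ]) ≡⟨ Σr-+ 0 (suc r) (λ j → [ α j ]) (λ j → [ β j ]) ⟩
            Σr 0 (suc r) (λ j → [inW] t (suc H + j)) + Σr 0 (suc r) (λ j → [inW] t (1 + j))
              ≡⟨ cong₂ _+_ (trans (Σr-from (suc H) (suc r)) (cong (λ z → Σr (suc H) z ([inW] t)) 1+r≡H))
                           (trans (Σr-from 1 (suc r)) (cong (λ z → Σr 1 z ([inW] t)) 1+r≡H)) ⟩
            Cc + A ≤⟨ ≤-trans (≤-reflexive (+-comm Cc A)) (m≤n+m _ ([inW] t 0)) ⟩
            [inW] t 0 + (A + Cc) ≡⟨ sym countW-split₂ ⟩
            countW t ∎
          where open ≤-Reasoning

    -- Besides base t from its antipodal path, every cycle but one needs an extra vertex of W,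
    -- forced by the pairs across two cycles.
    extra : Fin m → Bool
    extra zero = inW zero 1 ∧ inW zero 0
    extra (suc t) = if toℕ t ≡ᵇ k then (inW (suc t) (suc (h (suc t))) ∧ inW (suc t) (h (suc t))) else (inW (suc t) 1 ∨ inW (suc t) (h (suc t)))

    base : Fin m → ℕ
    base zero = h zero
    base (suc t) = if toℕ t ≡ᵇ k then h (suc t) else pred (h (suc t))

    base+extra≤countW : ∀ t → base t + [ extra t ] ≤ countW t
    base+extra≤countW zero = countW-first
    base+extra≤countW (suc t) with toℕ t ≡ᵇ k in e
    ... | true = countW-last (suc t) (cong suc (≡ᵇ⇒≡ _ _ (subst T (sym e) tt)))
    ... | false = countW-middle (suc t)

    1<N : ∀ t → 1 < C.N t
    1<N t = s≤s (≤-trans (h≥1 t) (m≤m+n (h t) (h t)))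

    ¬extra⇒exit-antipode∉W : ∀ (i j : Fin m) → toℕ i < toℕ j → ¬ T (extra i) →
                             Σ ℕ λ q → q < C.N i × RepPos i q × NonExitPos i q × (cdist i q (suc (h i)) ≡ h i) × ¬ T (inW i q)
    ¬extra⇒exit-antipode∉W zero j lt ne with ¬T-∧ {inW zero 1} ne
    ... | inj₁ f = 1 , 1<N zero , inj₁ (λ ()) , inj₁ (λ e → <-irrefl (cong pred e) (h≥1 zero)) , C.cycDist-+ zero 1 (h zero) ≤-refl , f
    ... | inj₂ f = 0 , s≤s z≤n , inj₂ refl , inj₁ (λ ()) , cdist-0-exit zero , f
    ¬extra⇒exit-antipode∉W (suc t) j lt ne with toℕ t ≡ᵇ k in e
    ... | true = ⊥-elim (<-irrefl refl (<-≤-trans (subst (_< toℕ j) (cong suc (≡ᵇ⇒≡ _ _ (subst T (sym e) tt))) lt) (≤-pred (toℕ<n j))))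
    ... | false = 1 , 1<N (suc t) , inj₁ (λ ()) , inj₁ (λ e → <-irrefl (cong pred e) (h≥1 (suc t))) , C.cycDist-+ (suc t) 1 (h (suc t)) ≤-refl , proj₁ (¬T-∨ {inW (suc t) 1} ne)

    ¬extra⇒first-antipode∉W : ∀ (i j : Fin m) → toℕ i < toℕ j → ¬ T (extra j) →
                              Σ ℕ λ q → q < C.N j × RepPos j q × NonExitPos j q × (cdist j 0 q ≡ h j) × ¬ T (inW j q)
    ¬extra⇒first-antipode∉W i zero lt ne = ⊥-elim (n≮0 lt)
    ¬extra⇒first-antipode∉W i (suc t) lt ne with toℕ t ≡ᵇ k in e
    ... | true with ¬T-∧ {inW (suc t) (suc (h (suc t)))} ne
    ...   | inj₁ f = suc (h (suc t)) , C.1+h<N (suc t) , inj₁ (λ ()) , inj₂ (cong suc (≡ᵇ⇒≡ _ _ (subst T (sym e) tt))) , cdist-0-exit (suc t) , f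
    ...   | inj₂ f = h (suc t) , s≤s (m≤m+n _ _) , inj₁ (λ z → <-irrefl (sym z) (h≥1 (suc t))) , inj₁ (λ z → <-irrefl z (n<1+n _))
                   , C.cycDist-+ (suc t) 0 (h (suc t)) ≤-refl , f
    ¬extra⇒first-antipode∉W i (suc t) lt ne | false =
      h (suc t) , s≤s (m≤m+n _ _) , inj₁ (λ z → <-irrefl (sym z) (h≥1 (suc t))) , inj₁ (λ z → <-irrefl z (n<1+n _))
                , C.cycDist-+ (suc t) 0 (h (suc t)) ≤-refl , proj₂ (¬T-∨ {inW (suc t) 1} ne)

    extra-pairwise : ∀ (i j : Fin m) → toℕ i < toℕ j → T (extra i ∨ extra j)
    extra-pairwise i j lt with extra i in ei
    ... | true = tt
    ... | false with extra j in ej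
    ...   | true = tt
    ...   | false with ¬extra⇒exit-antipode∉W i j lt (λ w → subst T ei w) | ¬extra⇒first-antipode∉W i j lt (λ w → subst T ej w)
    ...     | q1 , l1 , r1 , n1 , e1 , f1 | q2 , l2 , r2 , n2 , e2 , f2 with to (T-∨ {inW i q1}) (cross-pair-in-W i j q1 q2 lt l1 l2 r1 r2 n1 n2 e1 e2)
    ...       | inj₁ x = f1 x
    ...       | inj₂ x = f2 x

    Σbase≡ : ΣF base ≡ h zero + (Σmiddle + h (fromℕ (suc k)))
    Σbase≡ = trans (cong (h zero +_) (ΣF-snoc (λ t → base (suc t))))
                  (cong (h zero +_) (cong₂ _+_ (ΣF-cong _ _ (λ i → if-¬T (ne i))) (if-T (≡⇒≡ᵇ _ _ (toℕ-fromℕ k)))))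
      where
        ne : ∀ (i : Fin k) → ¬ T (toℕ (inject₁ i) ≡ᵇ k)
        ne i w = <-irrefl (trans (sym (toℕ-inject₁ i)) (≡ᵇ⇒≡ _ _ w)) (toℕ<n i)

    sdimValue≤length : sdimValue ≤ length W
    sdimValue≤length = begin
        sdimValue ≡⟨ sdimValue≡ ⟩
        h zero + (Σmiddle + h (fromℕ (suc k))) + suc k ≡⟨ cong (_+ suc k) (sym Σbase≡) ⟩
        ΣF base + suc k ≤⟨ +-monoʳ-≤ (ΣF base) (pairwise-∨⇒≥ (suc k) extra extra-pairwise) ⟩
        ΣF base + ΣF (λ t → [ extra t ]) ≡⟨ sym (ΣF-+ base (λ t → [ extra t ])) ⟩
        ΣF (λ t → base t + [ extra t ]) ≤⟨ ΣF-mono _ _ base+extra≤countW ⟩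
        ΣF countW ≡⟨ sym (ΣF-cong _ _ (ΣV-memberAt W)) ⟩
        ΣV (λ x → [ memberᴰ W x ]) ≤⟨ ΣV-member≤length W ⟩
        length W ∎
      where open ≤-Reasoning

  sdim : SDim (chainCycle m n) sdimValue
  sdim = (W* , W*-unique , W*-isStrongResolving , length-W*≡sdimValue)
       , λ W _ resolving → LowerBound.sdimValue≤length W resolving

theorem3p8 : (k : ℕ) (n : Fin (suc (suc k)) → ℕ)
  → (∀ i → n i % 2 ≡ 1) → (∀ i → 5 ≤ n i)
  → SDim (chainCycle (suc (suc k)) n)
      (suc k + n zero / 2 + n (fromℕ (suc k)) / 2
        + sum (map (λ i → (n (suc (inject₁ i)) ∸ 2) / 2) (allFin k)))
theorem3p8 k n n-odd n≥5 = ChainCycle.sdim k n n-odd n≥5
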